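{- Every tree of radius $2$ is planar unavoidable.
   Context: A graph $H$ is planar unavoidable if there exists a planar graph $G$ such that every coloring of the edges of $G$ with two colors (red and blue) contains a monochromatic copy of $H$ (a subgraph isomorphic to $H$ all of whose edges have the same color). -}

module Defs where

open import Data.Nat using (ℕ; zero; suc)
open import Data.Fin using (Fin; inject₁; fromℕ) renaming (zero to fzero; suc to fsuc)
open import Data.Bool using (Bool; true; false)
open import Data.Product using (Σ; ∃; ∃-syntax; _×_; _,_; proj₁; proj₂)
open import Data.Sum using (_⊎_)
open import Data.Rational using (ℚ; 0ℚ; 1ℚ; _≤_; _+_; _*_; _-_)
open import Relation.Binary.PropositionalEquality using (_≡_; _≢_)
open import Relation.Nullary using (¬_)
open import Function.Definitions using (Injective)

record Graph : Set where
  field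
    n     : ℕ
    adj   : Fin n → Fin n → Bool
    sym   : ∀ u v → adj u v ≡ adj v u
    irref : ∀ u → adj u u ≡ false
open Graph public

Edge : (G : Graph) → Fin (n G) → Fin (n G) → Set
Edge G u v = adj G u v ≡ true

Within : (G : Graph) → ℕ → Fin (n G) → Fin (n G) → Set
Within G zero    u v = u ≡ v
Within G (suc k) u v = u ≡ v ⊎ (∃[ w ] (Edge G u w × Within G k w v))

Connected : Graph → Set
Connected G = ∀ u v → ∃[ k ] Within G k u v

HasCycle : Graph → Set
HasCycle G =
  ∃[ m ] Σ (Fin (suc (suc (suc m))) → Fin (n G)) λ p →
    Injective _≡_ _≡_ p
    × (∀ (i : Fin (suc (suc m))) → Edge G (p (inject₁ i)) (p (fsuc i)))
    × Edge G (p (fromℕ (suc (suc m)))) (p fzero)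

IsTree : Graph → Set
IsTree G = Fin (n G) × Connected G × ¬ HasCycle G

-- Radius exactly r: some vertex has eccentricity ≤ r, and every vertex has
-- eccentricity ≥ r (i.e. not ≤ r-1).
RadiusIs : Graph → ℕ → Set
RadiusIs G zero    = ∃[ c ] (∀ u → Within G zero c u)
RadiusIs G (suc r) = (∃[ c ] (∀ u → Within G (suc r) c u))
                   × (∀ c → ∃[ u ] ¬ Within G r c u)

Pt : Set
Pt = ℚ × ℚ

OnSeg : Pt → Pt → Pt → Set
OnSeg p a b = ∃[ t ] (0ℚ ≤ t × t ≤ 1ℚ
  × proj₁ p ≡ proj₁ a + t * (proj₁ b - proj₁ a)
  × proj₂ p ≡ proj₂ a + t * (proj₂ b - proj₂ a))

SegsMeet : Pt → Pt → Pt → Pt → Set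
SegsMeet a b c d = ∃[ p ] (OnSeg p a b × OnSeg p c d)

Planar : Graph → Set
Planar G = Σ (Fin (n G) → Pt) λ pos →
    Injective _≡_ _≡_ pos
  × (∀ a b w → Edge G a b → w ≢ a → w ≢ b → ¬ OnSeg (pos w) (pos a) (pos b))
  × (∀ a b c d → Edge G a b → Edge G c d →
       a ≢ c → a ≢ d → b ≢ c → b ≢ d →
       ¬ SegsMeet (pos a) (pos b) (pos c) (pos d))

-- A 2-colouring of the edges of G (colour of edge uv is col u v; only its
-- values on edges matter), required to be symmetric.
Colouring : Graph → Set
Colouring G = Σ (Fin (n G) → Fin (n G) → Bool) λ col → ∀ u v → col u v ≡ col v u

MonoCopy : (H G : Graph) → (Fin (n G) → Fin (n G) → Bool) → Bool → Set
MonoCopy H G col κ = Σ (Fin (n H) → Fin (n G)) λ f →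
    Injective _≡_ _≡_ f
  × (∀ u v → Edge H u v → Edge G (f u) (f v) × col (f u) (f v) ≡ κ)

PlanarUnavoidable : Graph → Set
PlanarUnavoidable H = ∃[ G ] (Planar G ×
  ((c : Colouring G) → ∃[ κ ] MonoCopy H G (proj₁ c) κ))

-- Let c be a centre of T. Every vertex lies within distance 2 of c, and since T has no
-- cycles (of length 3, 4 or 5) its vertices hang off c like a spider: T embeds into the
-- spider whose N = n T legs are stars with N leaves. It therefore suffices to build a
-- planar graph in which every 2-colouring contains a monochromatic such spider.
--
-- The host graph, for K = 4N, has a root v₀, hubs v₁ i, twigs v₂ i j, buds v₃ i j l and
-- leaves v₄ i j l m, with arcs root–hub, hub–twig, hub–bud, twig–bud and bud–leaf. Fix a
-- hub and a colour α. Either N hub–twig arcs have colour α (an α-fan at the hub) or N have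
-- colour ¬α; then either each of these twigs has N buds in colour ¬α (a spider at the
-- hub), or one twig has 3N buds in colour α. Of those buds, either N have N leaves in
-- colour α (a spider at the twig) or 2N have N leaves in colour ¬α, and among the latter
-- the hub–bud arcs give N buds of colour α (an α-fan) or N of colour ¬α (a spider at the
-- hub). So, failing a spider, every hub has fans of both colours, and N root–hub arcs of a
-- common colour κ together with the κ-fans of their hubs form a κ-spider.
--
-- The drawing puts twigs, buds and leaves on the parabola y = x² at integer abscissae
-- ordered lexicographically by (hub, twig, bud, leaf), the hubs on a line y = β below it
-- and the root further down. Chords between points of the parabola lie above it and form
-- a laminar family; every hub lies below the tangents at the points of its own strip, so
-- its segments to them stay below the parabola, and distinct hubs use disjoint strips.

module Submission where

open import Data.Bool using (Bool; true; false; not; _∨_)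
import Data.Bool.Properties as BoolP
open import Data.Empty using (⊥; ⊥-elim)
open import Data.Fin using (Fin; toℕ; combine; inject₁; fromℕ) renaming (zero to fzero; suc to fsuc)
import Data.Fin.Properties as FinP
open import Data.Integer as ℤ using (+_)
import Data.Integer.Properties as ℤP
open import Data.Nat as ℕ using (ℕ; zero; suc; z≤n; s≤s)
open import Data.Nat.Coprimality using (1-coprimeTo) renaming (sym to Coprime-sym)
import Data.Nat.Properties as ℕP
open import Data.Nat.Tactic.RingSolver using (solve-∀)
open import Data.Product using (Σ; ∃-syntax; _×_; _,_; proj₁; proj₂)
open import Data.Product.Function.NonDependent.Propositional using (_×-↔_)
import Data.Rational as Rational
open Rational using (ℚ; mkℚ)
import Data.Rational.Properties as ℚP
open import Data.Rational.Solver using (module +-*-Solver)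
open import Data.Sum as Sum using (_⊎_; inj₁; inj₂; [_,_]′)
open import Data.Sum.Function.Propositional using (_⊎-↔_)
open import Data.Unit using (⊤; tt)
open import Data.Vec using (Vec; []; _∷_; lookup)
open import Data.Vec.Relation.Unary.All using ([]; _∷_)
open import Data.Vec.Relation.Unary.AllPairs using ([]; _∷_)
open import Data.Vec.Relation.Unary.Unique.Propositional using (Unique)
open import Data.Vec.Relation.Unary.Unique.Propositional.Properties using (lookup-injective)
open import Function using (_∘_; _↔_; mk↔ₛ′; Inverse)
open import Function.Definitions using (Injective)
open import Function.Properties.Inverse using (↔-refl; ↔-sym; ↔-trans; ↔⇒↣)
open import Relation.Binary.Definitions using (DecidableEquality; Symmetric; tri<; tri≈; tri>)
open import Relation.Binary.PropositionalEquality
open import Relation.Nullary using (¬_; Dec; yes; no; does)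
open import Relation.Nullary.Decidable using (map′; _⊎-dec_)

open import Defs renaming (sym to adj-sym)

-- Pigeonhole

record AtLeast {V : Set} (a : ℕ) (P : V → Set) : Set where
  constructor pick
  field
    index           : Fin a → V
    index-injective : Injective _≡_ _≡_ index
    holds           : ∀ r → P (index r)

AtLeast-zero : ∀ {V} {P : V → Set} → AtLeast 0 P
AtLeast-zero = pick (λ ()) (λ { {()} }) (λ ())

AtLeast-map : ∀ {V W : Set} {P : V → Set} {Q : W → Set} {a} (f : V → W) → Injective _≡_ _≡_ f →
              (∀ {v} → P v → Q (f v)) → AtLeast a P → AtLeast a Q
AtLeast-map f f-inj P⇒Q (pick g g-inj Pg) = pick (f ∘ g) (g-inj ∘ f-inj) (P⇒Q ∘ Pg)

AtLeast-weaken : ∀ {K a} {P : Fin (suc K) → Set} → AtLeast a (P ∘ fsuc) → AtLeast a P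
AtLeast-weaken = AtLeast-map fsuc FinP.suc-injective (λ Pv → Pv)

AtLeast-cons : ∀ {K a} {P : Fin (suc K) → Set} → P fzero → AtLeast a (P ∘ fsuc) → AtLeast (suc a) P
AtLeast-cons {K} {a} {P} P0 (pick f f-inj Pf) = pick g g-inj Pg
  where
  g : Fin (suc a) → Fin (suc K)
  g fzero    = fzero
  g (fsuc r) = fsuc (f r)
  g-inj : Injective _≡_ _≡_ g
  g-inj {fzero}  {fzero}  _ = refl
  g-inj {fsuc _} {fsuc _} e = cong fsuc (f-inj (FinP.suc-injective e))
  Pg : ∀ r → P (g r)
  Pg fzero    = P0
  Pg (fsuc r) = Pf r

pigeonhole : ∀ K {P Q : Fin K → Set} → (∀ j → P j ⊎ Q j) →
             ∀ a b → a ℕ.+ b ℕ.≤ suc K → AtLeast a P ⊎ AtLeast b Q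
pigeonhole K       split zero    b       _ = inj₁ AtLeast-zero
pigeonhole K       split (suc a) zero    _ = inj₂ AtLeast-zero
pigeonhole zero    split (suc a) (suc b) (s≤s a+1+b≤0) with () ← subst (ℕ._≤ 0) (ℕP.+-suc a b) a+1+b≤0
pigeonhole (suc K) {P} {Q} split (suc a) (suc b) (s≤s a+1+b≤1+K) with split fzero
... | inj₁ P0 with pigeonhole K {P ∘ fsuc} {Q ∘ fsuc} (split ∘ fsuc) a (suc b) a+1+b≤1+K
...   | inj₁ as = inj₁ (AtLeast-cons P0 as)
...   | inj₂ bs = inj₂ (AtLeast-weaken bs)
pigeonhole (suc K) {P} {Q} split (suc a) (suc b) (s≤s a+1+b≤1+K) | inj₂ Q0
  with pigeonhole K {P ∘ fsuc} {Q ∘ fsuc} (split ∘ fsuc) (suc a) b (subst (ℕ._≤ suc K) (ℕP.+-suc a b) a+1+b≤1+K)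
... | inj₁ as = inj₁ (AtLeast-weaken as)
... | inj₂ bs = inj₂ (AtLeast-cons Q0 bs)

escape-or-all : ∀ {n} {A : Set} {B : Fin n → Set} → (∀ i → A ⊎ B i) → A ⊎ (∀ i → B i)
escape-or-all {zero}  decide = inj₂ (λ ())
escape-or-all {suc n} decide with decide fzero | escape-or-all (decide ∘ fsuc)
... | inj₁ a  | _        = inj₁ a
... | inj₂ _  | inj₁ a   = inj₁ a
... | inj₂ b0 | inj₂ bs  = inj₂ λ { fzero → b0 ; (fsuc i) → bs i }

-- Spiders and trees of radius two

record Spider {V : Set} (R : V → V → Set) (N : ℕ) : Set where
  field
    centre : V
    middle : Fin N → V
    leaf   : Fin N → Fin N → V
    middle-injective : Injective _≡_ _≡_ middle
    leaf-injective   : ∀ {r r′ q q′} → leaf r q ≡ leaf r′ q′ → r ≡ r′ × q ≡ q′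
    centre≢middle    : ∀ r → centre ≢ middle r
    centre≢leaf      : ∀ r q → centre ≢ leaf r q
    middle≢leaf      : ∀ r r′ q → middle r ≢ leaf r′ q
    centre-middle    : ∀ r → R centre (middle r)
    middle-leaf      : ∀ r q → R (middle r) (leaf r q)

Spider-map : ∀ {V W : Set} {R : V → V → Set} {S : W → W → Set} {N} (f : V → W) →
             Injective _≡_ _≡_ f → (∀ {a b} → R a b → S (f a) (f b)) → Spider R N → Spider S N
Spider-map f f-inj f-hom s = record
  { centre = f centre ; middle = f ∘ middle ; leaf = λ r q → f (leaf r q)
  ; middle-injective = middle-injective ∘ f-inj
  ; leaf-injective   = leaf-injective ∘ f-inj
  ; centre≢middle    = λ r → centre≢middle r ∘ f-inj
  ; centre≢leaf      = λ r q → centre≢leaf r q ∘ f-inj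
  ; middle≢leaf      = λ r r′ q → middle≢leaf r r′ q ∘ f-inj
  ; centre-middle    = f-hom ∘ centre-middle
  ; middle-leaf      = λ r q → f-hom (middle-leaf r q) }
  where open Spider s

module _ (T : Graph) where

  Edge-sym : ∀ {a b} → Edge T a b → Edge T b a
  Edge-sym {a} {b} e = trans (adj-sym T b a) e

  Edge⇒≢ : ∀ {a b} → Edge T a b → a ≢ b
  Edge⇒≢ {a} e refl with () ← trans (sym e) (irref T a)

  cycle : ∀ {m} (vs : Vec (Fin (n T)) (3 ℕ.+ m)) → Unique vs →
          (∀ i → Edge T (lookup vs (inject₁ i)) (lookup vs (fsuc i))) →
          Edge T (lookup vs (fromℕ (2 ℕ.+ m))) (lookup vs fzero) → HasCycle T
  cycle {m} vs distinct path closing = m , lookup vs , lookup-injective distinct _ _ , path , closing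

  triangle : ∀ {v₀ v₁ v₂} → v₀ ≢ v₁ → v₀ ≢ v₂ → v₁ ≢ v₂ →
             Edge T v₀ v₁ → Edge T v₁ v₂ → Edge T v₂ v₀ → HasCycle T
  triangle d01 d02 d12 e0 e1 e2 =
    cycle (_ ∷ _ ∷ _ ∷ []) ((d01 ∷ d02 ∷ []) ∷ (d12 ∷ []) ∷ [] ∷ [])
      (λ { fzero → e0 ; (fsuc fzero) → e1 }) e2

  square : ∀ {v₀ v₁ v₂ v₃} → v₀ ≢ v₁ → v₀ ≢ v₂ → v₀ ≢ v₃ → v₁ ≢ v₂ → v₁ ≢ v₃ → v₂ ≢ v₃ →
           Edge T v₀ v₁ → Edge T v₁ v₂ → Edge T v₂ v₃ → Edge T v₃ v₀ → HasCycle T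
  square d01 d02 d03 d12 d13 d23 e0 e1 e2 e3 =
    cycle (_ ∷ _ ∷ _ ∷ _ ∷ []) ((d01 ∷ d02 ∷ d03 ∷ []) ∷ (d12 ∷ d13 ∷ []) ∷ (d23 ∷ []) ∷ [] ∷ [])
      (λ { fzero → e0 ; (fsuc fzero) → e1 ; (fsuc (fsuc fzero)) → e2 }) e3

  pentagon : ∀ {v₀ v₁ v₂ v₃ v₄} → v₀ ≢ v₁ → v₀ ≢ v₂ → v₀ ≢ v₃ → v₀ ≢ v₄ → v₁ ≢ v₂ → v₁ ≢ v₃ →
             v₁ ≢ v₄ → v₂ ≢ v₃ → v₂ ≢ v₄ → v₃ ≢ v₄ →
             Edge T v₀ v₁ → Edge T v₁ v₂ → Edge T v₂ v₃ → Edge T v₃ v₄ → Edge T v₄ v₀ → HasCycle T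
  pentagon d01 d02 d03 d04 d12 d13 d14 d23 d24 d34 e0 e1 e2 e3 e4 =
    cycle (_ ∷ _ ∷ _ ∷ _ ∷ _ ∷ [])
      ((d01 ∷ d02 ∷ d03 ∷ d04 ∷ []) ∷ (d12 ∷ d13 ∷ d14 ∷ []) ∷ (d23 ∷ d24 ∷ []) ∷ (d34 ∷ []) ∷ [] ∷ [])
      (λ { fzero → e0 ; (fsuc fzero) → e1 ; (fsuc (fsuc fzero)) → e2 ; (fsuc (fsuc (fsuc fzero))) → e3 }) e4

module RadiusTwoTree (T : Graph) (acyclic : ¬ HasCycle T)
                     (c : Fin (n T)) (near : ∀ u → Within T 2 c u) where

  V : Set
  V = Fin (n T)

  data Depth (u : V) : Set where
    root       : c ≡ u → Depth u
    child      : c ≢ u → Edge T c u → Depth u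
    grandchild : c ≢ u → adj T c u ≡ false → (p : V) → Edge T c p → Edge T p u → Depth u

  Edge⇒adj-true : ∀ {a b} → Edge T a b → adj T a b ≢ false
  Edge⇒adj-true e f with () ← trans (sym e) f

  parent : ∀ {u} → c ≢ u → adj T c u ≡ false → Within T 2 c u → ∃[ p ] Edge T c p × Edge T p u
  parent c≢u _     (inj₁ c≡u)                          = ⊥-elim (c≢u c≡u)
  parent _   c≁u   (inj₂ (w , cw , inj₁ refl))         = ⊥-elim (Edge⇒adj-true cw c≁u)
  parent _   _     (inj₂ (w , cw , inj₂ (_ , wu , refl))) = w , cw , wu

  depth : ∀ u → Depth u
  depth u with c FinP.≟ u
  ... | yes c≡u = root c≡u
  ... | no c≢u with adj T c u in c~u
  ...   | true  = child c≢u c~u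
  ...   | false = let p , cp , pu = parent c≢u c~u (near u) in grandchild c≢u c~u p cp pu

  module _ {W : Set} {R : W → W → Set} (R-sym : Symmetric R) (S : Spider R (n T)) where

    open Spider S

    place : ∀ {u} → Depth u → W
    place (root _)                  = centre
    place {u} (child _ _)           = middle u
    place {u} (grandchild _ _ p _ _) = leaf p u

    place-injective : ∀ {u v} (du : Depth u) (dv : Depth v) → place du ≡ place dv → u ≡ v
    place-injective (root c≡u)            (root c≡v)            _ = trans (sym c≡u) c≡v
    place-injective (root _)              (child _ _)           e = ⊥-elim (centre≢middle _ e)
    place-injective (root _)              (grandchild _ _ p _ _) e = ⊥-elim (centre≢leaf p _ e)
    place-injective (child _ _)           (root _)              e = ⊥-elim (centre≢middle _ (sym e))
    place-injective (child _ _)           (child _ _)           e = middle-injective e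
    place-injective (child _ _)           (grandchild _ _ p _ _) e = ⊥-elim (middle≢leaf _ p _ e)
    place-injective (grandchild _ _ p _ _) (root _)             e = ⊥-elim (centre≢leaf p _ (sym e))
    place-injective (grandchild _ _ p _ _) (child _ _)          e = ⊥-elim (middle≢leaf _ p _ (sym e))
    place-injective (grandchild _ _ _ _ _) (grandchild _ _ _ _ _) e = proj₂ (leaf-injective e)

    place-edge : ∀ {u v} (du : Depth u) (dv : Depth v) → Edge T u v → R (place du) (place dv)
    place-edge (root refl)   (root refl)   uv = ⊥-elim (Edge⇒≢ T uv refl)
    place-edge (root refl)   (child _ _)   uv = centre-middle _
    place-edge (root refl)   (grandchild _ c≁v _ _ _) uv = ⊥-elim (Edge⇒adj-true uv c≁v)
    place-edge (child _ _)   (root refl)   uv = R-sym (centre-middle _)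
    place-edge (child c≢u cu) (child c≢v cv) uv =
      ⊥-elim (acyclic (triangle T c≢u c≢v (Edge⇒≢ T uv) cu uv (Edge-sym T cv)))
    place-edge {u} {v} (child c≢u cu) (grandchild c≢v _ p cp pv) uv with p FinP.≟ u
    ... | yes refl = middle-leaf u v
    ... | no p≢u   = ⊥-elim (acyclic (square T (Edge⇒≢ T cp) c≢v c≢u (Edge⇒≢ T pv) p≢u
                                        (Edge⇒≢ T (Edge-sym T uv)) cp pv (Edge-sym T uv) (Edge-sym T cu)))
    place-edge (grandchild _ c≁u _ _ _) (root refl) uv = ⊥-elim (Edge⇒adj-true (Edge-sym T uv) c≁u)
    place-edge {u} {v} (grandchild c≢u _ p cp pu) (child c≢v cv) uv with p FinP.≟ v
    ... | yes refl = R-sym (middle-leaf v u)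
    ... | no p≢v   = ⊥-elim (acyclic (square T (Edge⇒≢ T cp) c≢u c≢v (Edge⇒≢ T pu) p≢v (Edge⇒≢ T uv)
                                        cp pu uv (Edge-sym T cv)))
    place-edge {u} {v} (grandchild c≢u c≁u p cp pu) (grandchild c≢v c≁v p′ cp′ p′v) uv with p FinP.≟ p′
    ... | yes refl = ⊥-elim (acyclic (triangle T (Edge⇒≢ T pu) (Edge⇒≢ T p′v) (Edge⇒≢ T uv)
                                        pu uv (Edge-sym T p′v)))
    ... | no p≢p′  = ⊥-elim (acyclic (pentagon T (Edge⇒≢ T cp) c≢u c≢v (Edge⇒≢ T cp′)
                                        (Edge⇒≢ T pu) p≢v p≢p′ (Edge⇒≢ T uv) u≢p′ (Edge⇒≢ T (Edge-sym T p′v))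
                                        cp pu uv (Edge-sym T p′v) (Edge-sym T cp′)))
      where
      p≢v : p ≢ v
      p≢v refl = Edge⇒adj-true cp c≁v
      u≢p′ : u ≢ p′
      u≢p′ refl = Edge⇒adj-true cp′ c≁u

    embed : Σ (V → W) λ f → Injective _≡_ _≡_ f × (∀ u v → Edge T u v → R (f u) (f v))
    embed = (λ u → place (depth u))
          , (λ {u} {v} → place-injective (depth u) (depth v))
          , (λ u v → place-edge (depth u) (depth v))

module EnumeratedGraph {A : Set} {m : ℕ} (enumeration : A ↔ Fin m) (adjacent : A → A → Bool)
                       (adjacent-sym : ∀ a b → adjacent a b ≡ adjacent b a)
                       (adjacent-irreflexive : ∀ a → adjacent a a ≡ false) where

  open Inverse enumeration

  graph : Graph
  graph = record
    { n     = m
    ; adj   = λ u v → adjacent (from u) (from v)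
    ; sym   = λ u v → adjacent-sym (from u) (from v)
    ; irref = adjacent-irreflexive ∘ from
    }

  to-injective : Injective _≡_ _≡_ to
  to-injective {a} {b} e = trans (sym (strictlyInverseʳ a)) (trans (cong from e) (strictlyInverseʳ b))

  from-injective : Injective _≡_ _≡_ from
  from-injective {u} {v} e = trans (sym (strictlyInverseˡ u)) (trans (cong to e) (strictlyInverseˡ v))

  Edge-to : ∀ {a b} → adjacent a b ≡ true → Edge graph (to a) (to b)
  Edge-to {a} {b} ab = subst₂ (λ a′ b′ → adjacent a′ b′ ≡ true) (sym (strictlyInverseʳ a)) (sym (strictlyInverseʳ b)) ab

  planar : (pos : A → Pt) → Injective _≡_ _≡_ pos →
           (∀ {a b w} → adjacent a b ≡ true → w ≢ a → w ≢ b → ¬ OnSeg (pos w) (pos a) (pos b)) →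
           (∀ {a b c d} → adjacent a b ≡ true → adjacent c d ≡ true → a ≢ c → a ≢ d → b ≢ c → b ≢ d →
              ¬ SegsMeet (pos a) (pos b) (pos c) (pos d)) →
           Planar graph
  planar pos pos-injective avoids disjoint =
      pos ∘ from
    , from-injective ∘ pos-injective
    , (λ _ _ _ ab w≢a w≢b → avoids ab (w≢a ∘ from-injective) (w≢b ∘ from-injective))
    , (λ _ _ _ _ ab cd a≢c a≢d b≢c b≢d →
         disjoint ab cd (a≢c ∘ from-injective) (a≢d ∘ from-injective) (b≢c ∘ from-injective) (b≢d ∘ from-injective))

lex-< : ∀ b {q q′ d d′} → q ℕ.< q′ → d ℕ.< b → q ℕ.* b ℕ.+ d ℕ.< q′ ℕ.* b ℕ.+ d′
lex-< b {q} {q′} {d} {d′} q<q′ d<b = begin-strict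
  q ℕ.* b ℕ.+ d     <⟨ ℕP.+-monoʳ-< (q ℕ.* b) d<b ⟩
  q ℕ.* b ℕ.+ b     ≡⟨ ℕP.+-comm (q ℕ.* b) b ⟩
  suc q ℕ.* b       ≤⟨ ℕP.*-monoˡ-≤ b q<q′ ⟩
  q′ ℕ.* b          ≤⟨ ℕP.m≤m+n (q′ ℕ.* b) d′ ⟩
  q′ ℕ.* b ℕ.+ d′   ∎
  where open ℕP.≤-Reasoning

lex-injective : ∀ b {q q′ d d′} → d ℕ.< b → d′ ℕ.< b → q ℕ.* b ℕ.+ d ≡ q′ ℕ.* b ℕ.+ d′ → q ≡ q′ × d ≡ d′
lex-injective b {q} {q′} {d} {d′} d<b d′<b e with ℕP.<-cmp q q′
... | tri< q<q′ _ _ = ⊥-elim (ℕP.<-irrefl e (lex-< b q<q′ d<b))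
... | tri> _ _ q′<q = ⊥-elim (ℕP.<-irrefl (sym e) (lex-< b q′<q d′<b))
... | tri≈ _ refl _ = refl , ℕP.+-cancelˡ-≡ (q ℕ.* b) d d′ e

⟦_⟧ : ℕ → ℚ
⟦ n ⟧ = mkℚ (+ n) 0 (Coprime-sym (1-coprimeTo n))

⟦⟧-injective : ∀ {m n} → ⟦ m ⟧ ≡ ⟦ n ⟧ → m ≡ n
⟦⟧-injective e = ℤP.+-injective (cong Rational.ℚ.numerator e)

⟦⟧-normalize : ∀ n → Rational.normalize n 1 ≡ ⟦ n ⟧
⟦⟧-normalize n = ℚP.normalize-coprime (Coprime-sym (1-coprimeTo n))

⟦+⟧ : ∀ m n → ⟦ m ℕ.+ n ⟧ ≡ ⟦ m ⟧ Rational.+ ⟦ n ⟧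
⟦+⟧ m n = sym (trans (ℚP./-cong {q₁ = 1} {q₂ = 1} numerators refl) (⟦⟧-normalize (m ℕ.+ n)))
  where numerators : + m ℤ.* + 1 ℤ.+ + n ℤ.* + 1 ≡ + (m ℕ.+ n)
        numerators rewrite ℤP.*-identityʳ (+ m) | ℤP.*-identityʳ (+ n) = refl

⟦*⟧ : ∀ m n → ⟦ m ℕ.* n ⟧ ≡ ⟦ m ⟧ Rational.* ⟦ n ⟧
⟦*⟧ m n = sym (trans (ℚP./-cong {q₁ = 1} {q₂ = 1} (sym (ℤP.pos-* m n)) refl) (⟦⟧-normalize (m ℕ.* n)))

⟦≤⟧ : ∀ {m n} → m ℕ.≤ n → ⟦ m ⟧ Rational.≤ ⟦ n ⟧
⟦≤⟧ {m} {n} m≤n = Rational.*≤* (subst₂ ℤ._≤_ (sym (ℤP.*-identityʳ (+ m))) (sym (ℤP.*-identityʳ (+ n))) (ℤ.+≤+ m≤n))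

⟦<⟧ : ∀ {m n} → m ℕ.< n → ⟦ m ⟧ Rational.< ⟦ n ⟧
⟦<⟧ {m} {n} m<n = Rational.*<* (subst₂ ℤ._<_ (sym (ℤP.*-identityʳ (+ m))) (sym (ℤP.*-identityʳ (+ n))) (ℤ.+<+ m<n))

-- Segments, chords and tangents of the parabola

module Plane where

  open Rational using (0ℚ; 1ℚ; _≤_; _<_; _+_; _*_; _-_; -_; nonNegative; positive)
  open ℚP
  open +-*-Solver using (solve; _:+_; _:*_; _:-_; _:=_; con)

  0≤q-p : ∀ {p q} → p ≤ q → 0ℚ ≤ q - p
  0≤q-p {p} h = subst₂ _≤_ (+-inverseʳ p) refl (+-monoˡ-≤ (- p) h)

  0<q-p : ∀ {p q} → p < q → 0ℚ < q - p
  0<q-p {p} h = subst₂ _<_ (+-inverseʳ p) refl (+-monoˡ-< (- p) h)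

  p+[q-p]≡q : ∀ p q → p + (q - p) ≡ q
  p+[q-p]≡q = solve 2 (λ p q → p :+ (q :- p) := q) refl

  0≤q-p⇒p≤q : ∀ {p q} → 0ℚ ≤ q - p → p ≤ q
  0≤q-p⇒p≤q {p} {q} h = subst₂ _≤_ (+-identityʳ p) (p+[q-p]≡q p q) (+-monoʳ-≤ p h)

  0<q-p⇒p<q : ∀ {p q} → 0ℚ < q - p → p < q
  0<q-p⇒p<q {p} {q} h = subst₂ _<_ (+-identityʳ p) (p+[q-p]≡q p q) (+-monoʳ-< p h)

  *-nonNeg : ∀ {p q} → 0ℚ ≤ p → 0ℚ ≤ q → 0ℚ ≤ p * q
  *-nonNeg {p} {q} hp hq =
    nonNegative⁻¹ (p * q) {{nonNeg*nonNeg⇒nonNeg p {{nonNegative hp}} q {{nonNegative hq}}}}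

  *-pos : ∀ {p q} → 0ℚ < p → 0ℚ < q → 0ℚ < p * q
  *-pos {p} {q} hp hq = positive⁻¹ (p * q) {{pos*pos⇒pos p {{positive hp}} q {{positive hq}}}}

  square-nonNeg : ∀ p → 0ℚ ≤ p * p
  square-nonNeg p with ≤-total 0ℚ p
  ... | inj₁ 0≤p = *-nonNeg 0≤p 0≤p
  ... | inj₂ p≤0 = subst (0ℚ ≤_) (neg² p) (*-nonNeg (0≤q-p p≤0) (0≤q-p p≤0))
    where neg² : ∀ p → (0ℚ - p) * (0ℚ - p) ≡ p * p
          neg² = solve 1 (λ p → (con 0ℚ :- p) :* (con 0ℚ :- p) := p :* p) refl

  ≤∧≢⇒< : ∀ {p q : ℚ} → p ≤ q → p ≢ q → p < q
  ≤∧≢⇒< {p} {q} p≤q p≢q with <-cmp p q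
  ... | tri< p<q _ _ = p<q
  ... | tri≈ _ p≡q _ = ⊥-elim (p≢q p≡q)
  ... | tri> _ _ q<p = ⊥-elim (<-irrefl refl (≤-<-trans p≤q q<p))

  interpolate : ℚ → ℚ → ℚ → ℚ
  interpolate u v s = u + s * (v - u)

  interpolate-≤ : ∀ {s u v m} → 0ℚ ≤ s → s ≤ 1ℚ → u ≤ m → v ≤ m → interpolate u v s ≤ m
  interpolate-≤ {s} {u} {v} {m} 0≤s s≤1 u≤m v≤m = 0≤q-p⇒p≤q (subst (0ℚ ≤_) (sym (split m u v s))
    (+-mono-≤ (*-nonNeg (0≤q-p s≤1) (0≤q-p u≤m)) (*-nonNeg 0≤s (0≤q-p v≤m))))
    where
    split : ∀ m u v s → m - (u + s * (v - u)) ≡ (1ℚ - s) * (m - u) + s * (m - v)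
    split = solve 4 (λ m u v s → m :- (u :+ s :* (v :- u)) := (con 1ℚ :- s) :* (m :- u) :+ s :* (m :- v)) refl

  interpolate-≥ : ∀ {s u v m} → 0ℚ ≤ s → s ≤ 1ℚ → m ≤ u → m ≤ v → m ≤ interpolate u v s
  interpolate-≥ {s} {u} {v} {m} 0≤s s≤1 m≤u m≤v = 0≤q-p⇒p≤q (subst (0ℚ ≤_) (sym (split m u v s))
    (+-mono-≤ (*-nonNeg (0≤q-p s≤1) (0≤q-p m≤u)) (*-nonNeg 0≤s (0≤q-p m≤v))))
    where
    split : ∀ m u v s → (u + s * (v - u)) - m ≡ (1ℚ - s) * (u - m) + s * (v - m)
    split = solve 4 (λ m u v s → (u :+ s :* (v :- u)) :- m := (con 1ℚ :- s) :* (u :- m) :+ s :* (v :- m)) refl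

  interpolate-< : ∀ {s u v m} → 0ℚ ≤ s → s ≤ 1ℚ → u < m → v < m → interpolate u v s < m
  interpolate-< 0≤s s≤1 u<m v<m with ≤-total _ _
  ... | inj₁ u≤v = ≤-<-trans (interpolate-≤ 0≤s s≤1 u≤v ≤-refl) v<m
  ... | inj₂ v≤u = ≤-<-trans (interpolate-≤ 0≤s s≤1 ≤-refl v≤u) u<m

  X Y : Pt → ℚ
  X = proj₁
  Y = proj₂

  OnSeg⇒X≤ : ∀ {p a b m} → OnSeg p a b → X a ≤ m → X b ≤ m → X p ≤ m
  OnSeg⇒X≤ (s , 0≤s , s≤1 , refl , _) = interpolate-≤ 0≤s s≤1

  OnSeg⇒X< : ∀ {p a b m} → OnSeg p a b → X a < m → X b < m → X p < m
  OnSeg⇒X< (s , 0≤s , s≤1 , refl , _) = interpolate-< 0≤s s≤1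

  OnSeg⇒X≥ : ∀ {p a b m} → OnSeg p a b → m ≤ X a → m ≤ X b → m ≤ X p
  OnSeg⇒X≥ (s , 0≤s , s≤1 , refl , _) = interpolate-≥ 0≤s s≤1

  OnSeg⇒Y≤ : ∀ {p a b m} → OnSeg p a b → Y a ≤ m → Y b ≤ m → Y p ≤ m
  OnSeg⇒Y≤ (s , 0≤s , s≤1 , _ , refl) = interpolate-≤ 0≤s s≤1

  OnSeg⇒Y≥ : ∀ {p a b m} → OnSeg p a b → m ≤ Y a → m ≤ Y b → m ≤ Y p
  OnSeg⇒Y≥ (s , 0≤s , s≤1 , _ , refl) = interpolate-≥ 0≤s s≤1

  OnSeg-sym : ∀ {p a b} → OnSeg p a b → OnSeg p b a
  OnSeg-sym {a = a} {b} (s , 0≤s , s≤1 , refl , refl) =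
    1ℚ - s , 0≤q-p s≤1 , 0≤q-p⇒p≤q (subst (0ℚ ≤_) (1-[1-s] s) 0≤s) ,
    reverse (X a) (X b) s , reverse (Y a) (Y b) s
    where
    1-[1-s] : ∀ s → s ≡ 1ℚ - (1ℚ - s)
    1-[1-s] = solve 1 (λ s → s := con 1ℚ :- (con 1ℚ :- s)) refl
    reverse : ∀ u v s → u + s * (v - u) ≡ v + (1ℚ - s) * (u - v)
    reverse = solve 3 (λ u v s → u :+ s :* (v :- u) := v :+ (con 1ℚ :- s) :* (u :- v)) refl

  SegsMeet-swapˡ : ∀ {a b c d} → SegsMeet a b c d → SegsMeet b a c d
  SegsMeet-swapˡ {a} {b} (p , p∈ab , p∈cd) = p , OnSeg-sym {p} {a} {b} p∈ab , p∈cd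

  SegsMeet-swapʳ : ∀ {a b c d} → SegsMeet a b c d → SegsMeet a b d c
  SegsMeet-swapʳ {c = c} {d} (p , p∈ab , p∈cd) = p , p∈ab , OnSeg-sym {p} {c} {d} p∈cd

  interpolate-0 : ∀ u v → interpolate u v 0ℚ ≡ u
  interpolate-0 = solve 2 (λ u v → u :+ con 0ℚ :* (v :- u) := u) refl

  interpolate-1 : ∀ u v → interpolate u v 1ℚ ≡ v
  interpolate-1 = solve 2 (λ u v → u :+ con 1ℚ :* (v :- u) := v) refl

  interpolate-rises : ∀ {s u v} → 0ℚ < s → u < v → u < interpolate u v s
  interpolate-rises {s} {u} {v} 0<s u<v =
    0<q-p⇒p<q (subst (0ℚ <_) (sym (gap u v s)) (*-pos 0<s (0<q-p u<v)))
    where gap : ∀ u v s → (u + s * (v - u)) - u ≡ s * (v - u)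
          gap = solve 3 (λ u v s → (u :+ s :* (v :- u)) :- u := s :* (v :- u)) refl

  interpolate-falls : ∀ {s u v} → 0ℚ < s → v < u → interpolate u v s < u
  interpolate-falls {s} {u} {v} 0<s v<u =
    0<q-p⇒p<q (subst (0ℚ <_) (sym (gap u v s)) (*-pos 0<s (0<q-p v<u)))
    where gap : ∀ u v s → u - (u + s * (v - u)) ≡ s * (u - v)
          gap = solve 3 (λ u v s → u :- (u :+ s :* (v :- u)) := s :* (u :- v)) refl

  rising-OnSeg : ∀ {p a b} → OnSeg p a b → Y a < Y b → Y p ≤ Y a → X p ≡ X a
  rising-OnSeg {a = a} {b} (s , 0≤s , _ , refl , refl) ya<yb yp≤ya with <-cmp 0ℚ s
  ... | tri< 0<s _ _ = ⊥-elim (<-irrefl refl (<-≤-trans (interpolate-rises 0<s ya<yb) yp≤ya))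
  ... | tri≈ _ refl _ = interpolate-0 (X a) (X b)
  ... | tri> _ _ s<0 = ⊥-elim (<-irrefl refl (<-≤-trans s<0 0≤s))

  falling-OnSeg : ∀ {p a b} → OnSeg p a b → Y b < Y a → Y a ≤ Y p → X p ≡ X a
  falling-OnSeg {a = a} {b} (s , 0≤s , _ , refl , refl) yb<ya ya≤yp with <-cmp 0ℚ s
  ... | tri< 0<s _ _ = ⊥-elim (<-irrefl refl (<-≤-trans (interpolate-falls 0<s yb<ya) ya≤yp))
  ... | tri≈ _ refl _ = interpolate-0 (X a) (X b)
  ... | tri> _ _ s<0 = ⊥-elim (<-irrefl refl (<-≤-trans s<0 0≤s))

  parabola : ℚ → Pt
  parabola t = t , t * t

  chord-X : ∀ {p a b} → a ≤ b → OnSeg p (parabola a) (parabola b) → a ≤ X p × X p ≤ b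
  chord-X {p} {a} {b} a≤b p∈ab =
    OnSeg⇒X≥ {p} {parabola a} {parabola b} p∈ab ≤-refl a≤b ,
    OnSeg⇒X≤ {p} {parabola a} {parabola b} p∈ab a≤b ≤-refl

  chord-Y : ∀ {p a b} → OnSeg p (parabola a) (parabola b) → Y p ≡ X p * X p + (X p - a) * (b - X p)
  chord-Y {a = a} {b} (s , _ , _ , refl , refl) = height a b s
    where
    height : ∀ a b s → a * a + s * (b * b - a * a) ≡
      (a + s * (b - a)) * (a + s * (b - a)) + ((a + s * (b - a)) - a) * (b - (a + s * (b - a)))
    height = solve 3 (λ a b s → a :* a :+ s :* (b :* b :- a :* a) :=
      (a :+ s :* (b :- a)) :* (a :+ s :* (b :- a)) :+ ((a :+ s :* (b :- a)) :- a) :* (b :- (a :+ s :* (b :- a)))) refl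

  chord-above : ∀ {p a b} → a ≤ b → OnSeg p (parabola a) (parabola b) → X p * X p ≤ Y p
  chord-above {p} {a} {b} a≤b p∈ab = begin
    X p * X p                               ≡⟨ +-identityʳ (X p * X p) ⟨
    X p * X p + 0ℚ                          ≤⟨ +-monoʳ-≤ (X p * X p) (*-nonNeg (0≤q-p a≤x) (0≤q-p x≤b)) ⟩
    X p * X p + (X p - a) * (b - X p)       ≡⟨ chord-Y {p} {a} {b} p∈ab ⟨
    Y p                                     ∎
    where
    open ≤-Reasoning
    a≤x : a ≤ X p
    a≤x = proj₁ (chord-X {p} {a} {b} a≤b p∈ab)
    x≤b : X p ≤ b
    x≤b = proj₂ (chord-X {p} {a} {b} a≤b p∈ab)

  chord-strictly-above : ∀ {p a b} → a < X p → X p < b → OnSeg p (parabola a) (parabola b) → X p * X p < Y p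
  chord-strictly-above {p} {a} {b} a<x x<b p∈ab = begin-strict
    X p * X p                               ≡⟨ +-identityʳ (X p * X p) ⟨
    X p * X p + 0ℚ                          <⟨ +-monoʳ-< (X p * X p) (*-pos (0<q-p a<x) (0<q-p x<b)) ⟩
    X p * X p + (X p - a) * (b - X p)       ≡⟨ chord-Y {p} {a} {b} p∈ab ⟨
    Y p                                     ∎
    where open ≤-Reasoning

  chord-nonNeg : ∀ {p a b} → a ≤ b → OnSeg p (parabola a) (parabola b) → 0ℚ ≤ Y p
  chord-nonNeg {p} {a} {b} a≤b p∈ab = ≤-trans (square-nonNeg (X p)) (chord-above {p} {a} {b} a≤b p∈ab)

  parabola-on-chord⇒endpoint : ∀ {t a b} → a ≤ b → OnSeg (parabola t) (parabola a) (parabola b) →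
                               t ≢ a → t ≢ b → ⊥
  parabola-on-chord⇒endpoint {t} {a} {b} a≤b t∈ab t≢a t≢b =
    <-irrefl refl (chord-strictly-above {parabola t} {a} {b} a<t t<b t∈ab)
    where
    a<t : a < t
    a<t = ≤∧≢⇒< (proj₁ (chord-X {parabola t} {a} {b} a≤b t∈ab)) (t≢a ∘ sym)
    t<b : t < b
    t<b = ≤∧≢⇒< (proj₂ (chord-X {parabola t} {a} {b} a≤b t∈ab)) t≢b

  ordered-chords-disjoint : ∀ {a b c d} → a ≤ b → b < c → c ≤ d →
                            ¬ SegsMeet (parabola a) (parabola b) (parabola c) (parabola d)
  ordered-chords-disjoint {a} {b} {c} {d} a≤b b<c c≤d (p , p∈ab , p∈cd) =
    <-irrefl refl (≤-<-trans (proj₂ (chord-X {p} {a} {b} a≤b p∈ab))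
                             (<-≤-trans b<c (proj₁ (chord-X {p} {c} {d} c≤d p∈cd))))

  -- Over [c, d] the chord ab lies strictly above the chord cd.
  nested-chords-disjoint : ∀ {a b c d} → a < c → d < b → c ≤ d →
                           ¬ SegsMeet (parabola a) (parabola b) (parabola c) (parabola d)
  nested-chords-disjoint {a} {b} {c} {d} a<c d<b c≤d (p , p∈ab , p∈cd) = <-irrefl heights-equal inner<outer
    where
    x : ℚ
    x = X p
    c≤x : c ≤ x
    c≤x = proj₁ (chord-X {p} {c} {d} c≤d p∈cd)
    x≤d : x ≤ d
    x≤d = proj₂ (chord-X {p} {c} {d} c≤d p∈cd)
    heights-equal : (x - c) * (d - x) ≡ (x - a) * (b - x)
    heights-equal = +-cancelˡ (x * x) (trans (sym (chord-Y {p} {c} {d} p∈cd)) (chord-Y {p} {a} {b} p∈ab))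
      where
      +-cancelˡ : ∀ z {u v} → z + u ≡ z + v → u ≡ v
      +-cancelˡ z {u} {v} e = trans (cancel z u) (trans (cong (_- z) e) (sym (cancel z v)))
        where cancel : ∀ z u → u ≡ (z + u) - z
              cancel = solve 2 (λ z u → u := (z :+ u) :- z) refl
    difference : ∀ x a b c d → (x - a) * (b - x) - (x - c) * (d - x) ≡ (c - a) * (b - x) + (x - c) * (b - d)
    difference = solve 5 (λ x a b c d → (x :- a) :* (b :- x) :- (x :- c) :* (d :- x)
                                        := (c :- a) :* (b :- x) :+ (x :- c) :* (b :- d)) refl
    inner<outer : (x - c) * (d - x) < (x - a) * (b - x)
    inner<outer = 0<q-p⇒p<q (subst (0ℚ <_) (sym (difference x a b c d))
      (+-mono-<-≤ (*-pos (0<q-p a<c) (0<q-p (≤-<-trans x≤d d<b)))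
                  (*-nonNeg (0≤q-p c≤x) (0≤q-p (<⇒≤ d<b)))))

  -- The hypothesis says that (α, β) lies strictly below the tangent to the parabola at t.
  below-tangent⇒under-parabola : ∀ {p α β t} → β + t * t - (t + t) * α < 0ℚ →
                                  OnSeg p (α , β) (parabola t) → p ≡ parabola t ⊎ Y p < X p * X p
  below-tangent⇒under-parabola {α = α} {β} {t} below (s , 0≤s , s≤1 , refl , refl) with <-cmp s 1ℚ
  ... | tri≈ _ refl _ = inj₁ (cong₂ _,_ (interpolate-1 α t) (interpolate-1 β (t * t)))
  ... | tri> _ _ 1<s = ⊥-elim (<-irrefl refl (<-≤-trans 1<s s≤1))
  ... | tri< s<1 _ _ = inj₂ (0<q-p⇒p<q (subst (0ℚ <_) (sym (gap α β t s))
          (+-mono-<-≤ (*-pos (0<q-p s<1) (0<q-p below))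
                      (*-nonNeg (*-nonNeg (0≤q-p s≤1) (0≤q-p s≤1)) (square-nonNeg (α - t))))))
    where
    gap : ∀ α β t s → (α + s * (t - α)) * (α + s * (t - α)) - (β + s * (t * t - β))
            ≡ (1ℚ - s) * (0ℚ - (β + t * t - (t + t) * α)) + (1ℚ - s) * (1ℚ - s) * ((α - t) * (α - t))
    gap = solve 4 (λ α β t s → (α :+ s :* (t :- α)) :* (α :+ s :* (t :- α)) :- (β :+ s :* (t :* t :- β))
            := (con 1ℚ :- s) :* (con 0ℚ :- (β :+ t :* t :- (t :+ t) :* α))
               :+ (con 1ℚ :- s) :* (con 1ℚ :- s) :* ((α :- t) :* (α :- t))) refl

  data Laminar (s t s′ t′ : ℕ) : Set where
    before : t ℕ.< s′ → Laminar s t s′ t′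
    after  : t′ ℕ.< s → Laminar s t s′ t′
    inside : s′ ℕ.< s → t ℕ.< t′ → Laminar s t s′ t′
    around : s ℕ.< s′ → t′ ℕ.< t → Laminar s t s′ t′

  Laminar-sym : ∀ {s t s′ t′} → Laminar s t s′ t′ → Laminar s′ t′ s t
  Laminar-sym (before t<s′)        = after t<s′
  Laminar-sym (after t′<s)         = before t′<s
  Laminar-sym (inside s′<s t<t′)   = around s′<s t<t′
  Laminar-sym (around s<s′ t′<t)   = inside s<s′ t′<t

  laminar-chords-disjoint : ∀ {s t s′ t′} → s ℕ.≤ t → s′ ℕ.≤ t′ → Laminar s t s′ t′ →
    ¬ SegsMeet (parabola ⟦ s ⟧) (parabola ⟦ t ⟧) (parabola ⟦ s′ ⟧) (parabola ⟦ t′ ⟧)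
  laminar-chords-disjoint s≤t s′≤t′ (before t<s′) =
    ordered-chords-disjoint (⟦≤⟧ s≤t) (⟦<⟧ t<s′) (⟦≤⟧ s′≤t′)
  laminar-chords-disjoint s≤t s′≤t′ (after t′<s) (p , p∈st , p∈s′t′) =
    ordered-chords-disjoint (⟦≤⟧ s′≤t′) (⟦<⟧ t′<s) (⟦≤⟧ s≤t) (p , p∈s′t′ , p∈st)
  laminar-chords-disjoint s≤t s′≤t′ (inside s′<s t<t′) (p , p∈st , p∈s′t′) =
    nested-chords-disjoint (⟦<⟧ s′<s) (⟦<⟧ t<t′) (⟦≤⟧ s≤t) (p , p∈s′t′ , p∈st)
  laminar-chords-disjoint s≤t s′≤t′ (around s<s′ t′<t) =
    nested-chords-disjoint (⟦<⟧ s<s′) (⟦<⟧ t′<t) (⟦≤⟧ s′≤t′)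

-- The host graph and its drawing

module Host (K : ℕ) where

  data Vertex : Set where
    v₀ : Vertex
    v₁ : Fin K → Vertex
    v₂ : Fin K → Fin K → Vertex
    v₃ : Fin K → Fin K → Fin K → Vertex
    v₄ : Fin K → Fin K → Fin K → Fin K → Vertex

  data Arc : Vertex → Vertex → Set where
    arc₀₁ : ∀ i → Arc v₀ (v₁ i)
    arc₁₂ : ∀ i j → Arc (v₁ i) (v₂ i j)
    arc₁₃ : ∀ i j l → Arc (v₁ i) (v₃ i j l)
    arc₂₃ : ∀ i j l → Arc (v₂ i j) (v₃ i j l)
    arc₃₄ : ∀ i j l m → Arc (v₃ i j l) (v₄ i j l m)

  Code : Set
  Code = ⊤ ⊎ Fin K ⊎ Fin K × Fin K ⊎ Fin K × Fin K × Fin K ⊎ Fin K × Fin K × Fin K × Fin K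

  encode : Vertex → Code
  encode v₀           = inj₁ tt
  encode (v₁ i)       = inj₂ (inj₁ i)
  encode (v₂ i j)     = inj₂ (inj₂ (inj₁ (i , j)))
  encode (v₃ i j l)   = inj₂ (inj₂ (inj₂ (inj₁ (i , j , l))))
  encode (v₄ i j l m) = inj₂ (inj₂ (inj₂ (inj₂ (i , j , l , m))))

  decode : Code → Vertex
  decode (inj₁ tt)                                    = v₀
  decode (inj₂ (inj₁ i))                              = v₁ i
  decode (inj₂ (inj₂ (inj₁ (i , j))))                 = v₂ i j
  decode (inj₂ (inj₂ (inj₂ (inj₁ (i , j , l)))))      = v₃ i j l
  decode (inj₂ (inj₂ (inj₂ (inj₂ (i , j , l , m))))) = v₄ i j l m

  Vertex↔Code : Vertex ↔ Code
  Vertex↔Code = mk↔ₛ′ encode decode encode∘decode decode∘encode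
    where
    encode∘decode : ∀ c → encode (decode c) ≡ c
    encode∘decode (inj₁ tt)                       = refl
    encode∘decode (inj₂ (inj₁ _))                 = refl
    encode∘decode (inj₂ (inj₂ (inj₁ _)))          = refl
    encode∘decode (inj₂ (inj₂ (inj₂ (inj₁ _))))   = refl
    encode∘decode (inj₂ (inj₂ (inj₂ (inj₂ _))))   = refl
    decode∘encode : ∀ a → decode (encode a) ≡ a
    decode∘encode v₀             = refl
    decode∘encode (v₁ _)         = refl
    decode∘encode (v₂ _ _)       = refl
    decode∘encode (v₃ _ _ _)     = refl
    decode∘encode (v₄ _ _ _ _)   = refl

  size : ℕ
  size = 1 ℕ.+ (K ℕ.+ (K ℕ.* K ℕ.+ (K ℕ.* (K ℕ.* K) ℕ.+ K ℕ.* (K ℕ.* (K ℕ.* K)))))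

  Fin-size↔Code : Fin size ↔ Code
  Fin-size↔Code =
    ↔-trans FinP.+↔⊎ (FinP.1↔⊤ ⊎-↔
    ↔-trans FinP.+↔⊎ (↔-refl ⊎-↔
    ↔-trans FinP.+↔⊎ (Fin² ⊎-↔
    ↔-trans FinP.+↔⊎ (Fin³ ⊎-↔ Fin⁴))))
    where
    Fin² : Fin (K ℕ.* K) ↔ (Fin K × Fin K)
    Fin² = FinP.*↔×
    Fin³ : Fin (K ℕ.* (K ℕ.* K)) ↔ (Fin K × Fin K × Fin K)
    Fin³ = ↔-trans FinP.*↔× (↔-refl ×-↔ Fin²)
    Fin⁴ : Fin (K ℕ.* (K ℕ.* (K ℕ.* K))) ↔ (Fin K × Fin K × Fin K × Fin K)
    Fin⁴ = ↔-trans FinP.*↔× (↔-refl ×-↔ Fin³)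

  enumeration : Vertex ↔ Fin size
  enumeration = ↔-trans Vertex↔Code (↔-sym Fin-size↔Code)

  _≟_ : DecidableEquality Vertex
  _≟_ = FinP.inj⇒≟ (↔⇒↣ enumeration)

  arc? : ∀ a b → Dec (Arc a b)
  arc? a v₀           = no λ ()
  arc? a (v₁ i)       = map′ (λ { refl → arc₀₁ i }) (λ { (arc₀₁ _) → refl }) (a ≟ v₀)
  arc? a (v₂ i j)     = map′ (λ { refl → arc₁₂ i j }) (λ { (arc₁₂ _ _) → refl }) (a ≟ v₁ i)
  arc? a (v₃ i j l)   = map′ (λ { (inj₁ refl) → arc₁₃ i j l ; (inj₂ refl) → arc₂₃ i j l })
                             (λ { (arc₁₃ _ _ _) → inj₁ refl ; (arc₂₃ _ _ _) → inj₂ refl })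
                             (a ≟ v₁ i ⊎-dec a ≟ v₂ i j)
  arc? a (v₄ i j l m) = map′ (λ { refl → arc₃₄ i j l m }) (λ { (arc₃₄ _ _ _ _) → refl }) (a ≟ v₃ i j l)

  Arc-irreflexive : ∀ {a} → ¬ Arc a a
  Arc-irreflexive ()

  adjacent : Vertex → Vertex → Bool
  adjacent a b = does (arc? a b) ∨ does (arc? b a)

  adjacent-sym : ∀ a b → adjacent a b ≡ adjacent b a
  adjacent-sym a b = BoolP.∨-comm (does (arc? a b)) (does (arc? b a))

  adjacent-irreflexive : ∀ a → adjacent a a ≡ false
  adjacent-irreflexive a with arc? a a
  ... | yes aa = ⊥-elim (Arc-irreflexive aa)
  ... | no _   = refl

  Arc⇒adjacent : ∀ {a b} → Arc a b → adjacent a b ≡ true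
  Arc⇒adjacent {a} {b} ab with arc? a b
  ... | yes _  = refl
  ... | no ¬ab = ⊥-elim (¬ab ab)

  adjacent⇒Arc : ∀ a b → adjacent a b ≡ true → Arc a b ⊎ Arc b a
  adjacent⇒Arc a b _  with arc? a b | arc? b a
  adjacent⇒Arc a b _  | yes ab | _      = inj₁ ab
  adjacent⇒Arc a b _  | no _   | yes ba = inj₂ ba
  adjacent⇒Arc a b () | no _   | no _

  v₁-injective : ∀ {i i′} → v₁ i ≡ v₁ i′ → i ≡ i′
  v₁-injective refl = refl

  v₂-injective : ∀ {i j j′} → v₂ i j ≡ v₂ i j′ → j ≡ j′
  v₂-injective refl = refl

  v₃-injective : ∀ {i j l l′} → v₃ i j l ≡ v₃ i j l′ → l ≡ l′
  v₃-injective refl = refl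

  v₄-injective : ∀ {i j l m m′} → v₄ i j l m ≡ v₄ i j l m′ → m ≡ m′
  v₄-injective refl = refl

  level : Vertex → ℕ
  level v₀           = 0
  level (v₁ _)       = 1
  level (v₂ _ _)     = 2
  level (v₃ _ _ _)   = 3
  level (v₄ _ _ _ _) = 4

  Arc-level : ∀ {a b} → Arc a b → level a ℕ.< level b
  Arc-level (arc₀₁ _)       = ℕP.≤-refl
  Arc-level (arc₁₂ _ _)     = ℕP.≤-refl
  Arc-level (arc₁₃ _ _ _)   = ℕP.n≤1+n _
  Arc-level (arc₂₃ _ _ _)   = ℕP.≤-refl
  Arc-level (arc₃₄ _ _ _ _) = ℕP.≤-refl

  Arc-parent-unique : ∀ {a a′ b} → Arc a b → Arc a′ b → level a ≡ level a′ → a ≡ a′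
  Arc-parent-unique (arc₀₁ _)       (arc₀₁ _)       _ = refl
  Arc-parent-unique (arc₁₂ _ _)     (arc₁₂ _ _)     _ = refl
  Arc-parent-unique (arc₁₃ _ _ _)   (arc₁₃ _ _ _)   _ = refl
  Arc-parent-unique (arc₂₃ _ _ _)   (arc₂₃ _ _ _)   _ = refl
  Arc-parent-unique (arc₃₄ _ _ _ _) (arc₃₄ _ _ _ _) _ = refl
  Arc-parent-unique (arc₁₃ _ _ _)   (arc₂₃ _ _ _)   ()
  Arc-parent-unique (arc₂₃ _ _ _)   (arc₁₃ _ _ _)   ()

  level-≢ : ∀ {a b} → level a ℕ.< level b → a ≢ b
  level-≢ lt refl = ℕP.<-irrefl refl lt

  -- Arcs go up one level or more and every vertex has at most one parent per
  -- level, so legs hanging off middles of a common level never collide.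
  layered-spider : ∀ {N} {R : Vertex → Vertex → Set} → (∀ {a b} → R a b → Arc a b) →
           ∀ c (middles : AtLeast N (R c)) → (let open AtLeast middles) →
           (∀ r r′ → level (index r) ≡ level (index r′)) →
           (∀ r → AtLeast N (R (index r))) → Spider R N
  layered-spider {R = R} R⇒Arc c middles flat legs = record
    { centre = c ; middle = index ; leaf = leaf
    ; middle-injective = index-injective
    ; leaf-injective   = leaf-injective
    ; centre≢middle    = λ r → level-≢ (Arc-level (R⇒Arc (holds r)))
    ; centre≢leaf      = λ r q → level-≢ (ℕP.<-trans (Arc-level (R⇒Arc (holds r))) (Arc-level (leaf-arc r q)))
    ; middle≢leaf      = λ r r′ q → level-≢ (subst (ℕ._< _) (flat r′ r) (Arc-level (leaf-arc r′ q)))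
    ; centre-middle    = holds
    ; middle-leaf      = λ r → AtLeast.holds (legs r) }
    where
    open AtLeast middles
    leaf : _ → _ → Vertex
    leaf r = AtLeast.index (legs r)
    leaf-arc : ∀ r q → Arc (index r) (leaf r q)
    leaf-arc r q = R⇒Arc (AtLeast.holds (legs r) q)
    leaf-injective : ∀ {r r′ q q′} → leaf r q ≡ leaf r′ q′ → r ≡ r′ × q ≡ q′
    leaf-injective {r} {r′} e with index-injective (Arc-parent-unique (leaf-arc r _) (subst (Arc _) (sym e) (leaf-arc r′ _)) (flat r r′))
    ... | refl = refl , AtLeast.index-injective (legs r) e

  data Curve : Vertex → Set where
    curve₂ : ∀ i j     → Curve (v₂ i j)
    curve₃ : ∀ i j l   → Curve (v₃ i j l)
    curve₄ : ∀ i j l m → Curve (v₄ i j l m)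

  hub-of twig-of : ∀ {a} → Curve a → Fin K
  hub-of (curve₂ i _)       = i
  hub-of (curve₃ i _ _)     = i
  hub-of (curve₄ i _ _ _)   = i
  twig-of (curve₂ _ j)      = j
  twig-of (curve₃ _ j _)    = j
  twig-of (curve₄ _ j _ _)  = j

  radix cell stripWidth : ℕ
  radix      = suc K
  cell       = radix ℕ.* radix
  stripWidth = K ℕ.* cell

  digit₃ digit₄ : ∀ {a} → Curve a → ℕ
  digit₃ (curve₂ _ _)       = 0
  digit₃ (curve₃ _ _ l)     = suc (toℕ l)
  digit₃ (curve₄ _ _ l _)   = suc (toℕ l)
  digit₄ (curve₂ _ _)       = 0
  digit₄ (curve₃ _ _ _)     = 0
  digit₄ (curve₄ _ _ _ m)   = suc (toℕ m)

  digit₃<radix : ∀ {a} (c : Curve a) → digit₃ c ℕ.< radix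
  digit₃<radix (curve₂ _ _)     = s≤s z≤n
  digit₃<radix (curve₃ _ _ l)   = s≤s (FinP.toℕ<n l)
  digit₃<radix (curve₄ _ _ l _) = s≤s (FinP.toℕ<n l)

  digit₄<radix : ∀ {a} (c : Curve a) → digit₄ c ℕ.< radix
  digit₄<radix (curve₂ _ _)     = s≤s z≤n
  digit₄<radix (curve₃ _ _ _)   = s≤s z≤n
  digit₄<radix (curve₄ _ _ _ m) = s≤s (FinP.toℕ<n m)

  block : ∀ {a} → Curve a → ℕ
  block c = toℕ (combine (hub-of c) (twig-of c))

  inner : ∀ {a} → Curve a → ℕ
  inner c = digit₃ c ℕ.* radix ℕ.+ digit₄ c

  inner<cell : ∀ {a} (c : Curve a) → inner c ℕ.< cell
  inner<cell c = subst (inner c ℕ.<_) (ℕP.+-identityʳ cell) (lex-< radix (digit₃<radix c) (digit₄<radix c))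

  -- The parabola parameter of a curve vertex, read as the digits
  -- (hub, twig, digit₃, digit₄) in mixed radix (K, K, K+1, K+1).
  param : ∀ {a} → Curve a → ℕ
  param c = block c ℕ.* cell ℕ.+ inner c

  Curve-injective : ∀ {a b} (c : Curve a) (c′ : Curve b) → hub-of c ≡ hub-of c′ → twig-of c ≡ twig-of c′ →
                    digit₃ c ≡ digit₃ c′ → digit₄ c ≡ digit₄ c′ → a ≡ b
  Curve-injective (curve₂ _ _)     (curve₂ _ _)     refl refl _  _  = refl
  Curve-injective (curve₃ i j _)   (curve₃ _ _ _)   refl refl e₃ _  =
    cong (v₃ i j) (FinP.toℕ-injective (ℕP.suc-injective e₃))
  Curve-injective (curve₄ i j _ _) (curve₄ _ _ _ _) refl refl e₃ e₄ =
    cong₂ (v₄ i j) (FinP.toℕ-injective (ℕP.suc-injective e₃)) (FinP.toℕ-injective (ℕP.suc-injective e₄))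
  Curve-injective (curve₂ _ _)     (curve₃ _ _ _)   _ _ () _
  Curve-injective (curve₂ _ _)     (curve₄ _ _ _ _) _ _ () _
  Curve-injective (curve₃ _ _ _)   (curve₂ _ _)     _ _ () _
  Curve-injective (curve₃ _ _ _)   (curve₄ _ _ _ _) _ _ _ ()
  Curve-injective (curve₄ _ _ _ _) (curve₂ _ _)     _ _ () _
  Curve-injective (curve₄ _ _ _ _) (curve₃ _ _ _)   _ _ _ ()

  param-injective : ∀ {a b} (c : Curve a) (c′ : Curve b) → param c ≡ param c′ → a ≡ b
  param-injective c c′ e
    with blocks , inners ← lex-injective cell (inner<cell c) (inner<cell c′) e
    with hubs , twigs ← FinP.combine-injective _ _ _ _ (FinP.toℕ-injective blocks)
    with e₃ , e₄ ← lex-injective radix (digit₄<radix c) (digit₄<radix c′) inners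
    = Curve-injective c c′ hubs twigs e₃ e₄

  strip : Fin K → ℕ
  strip i = toℕ i ℕ.* stripWidth

  strip-< : ∀ {i i′ : Fin K} → toℕ i ℕ.< toℕ i′ → strip i ℕ.< strip i′
  strip-< {i′ = i′} = ℕP.*-monoˡ-< stripWidth {{ℕP.m*n≢0 K cell {{FinP.nonZeroIndex i′}}}}

  strip-injective : ∀ {i i′ : Fin K} → strip i ≡ strip i′ → i ≡ i′
  strip-injective {i} {i′} = FinP.toℕ-injective ∘ ℕP.*-cancelʳ-≡ (toℕ i) (toℕ i′) stripWidth {{ℕP.m*n≢0 K cell {{FinP.nonZeroIndex i}}}}

  offset : ∀ {a} → Curve a → ℕ
  offset c = toℕ (twig-of c) ℕ.* cell ℕ.+ inner c

  param≡strip+offset : ∀ {a} (c : Curve a) → param c ≡ strip (hub-of c) ℕ.+ offset c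
  param≡strip+offset c = begin
    block c ℕ.* cell ℕ.+ inner c                                    ≡⟨ cong (λ n → n ℕ.* cell ℕ.+ inner c) (FinP.toℕ-combine (hub-of c) (twig-of c)) ⟩
    (K ℕ.* toℕ (hub-of c) ℕ.+ toℕ (twig-of c)) ℕ.* cell ℕ.+ inner c ≡⟨ regroup K (toℕ (hub-of c)) (toℕ (twig-of c)) cell (inner c) ⟩
    strip (hub-of c) ℕ.+ offset c                                    ∎
    where
    open ≡-Reasoning
    regroup : ∀ K i j c d → (K ℕ.* i ℕ.+ j) ℕ.* c ℕ.+ d ≡ i ℕ.* (K ℕ.* c) ℕ.+ (j ℕ.* c ℕ.+ d)
    regroup = solve-∀

  offset<stripWidth : ∀ {a} (c : Curve a) → offset c ℕ.< stripWidth
  offset<stripWidth c =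
    subst (offset c ℕ.<_) (ℕP.+-identityʳ stripWidth) (lex-< cell (FinP.toℕ<n (twig-of c)) (inner<cell c))

  strip≤param : ∀ {a} (c : Curve a) → strip (hub-of c) ℕ.≤ param c
  strip≤param c = subst (strip (hub-of c) ℕ.≤_) (sym (param≡strip+offset c)) (ℕP.m≤m+n _ _)

  param<strip : ∀ {a} (c : Curve a) {i′} → toℕ (hub-of c) ℕ.< toℕ i′ → param c ℕ.< strip i′
  param<strip c {i′} hub<i′ = subst₂ ℕ._<_ (sym (param≡strip+offset c)) (ℕP.+-identityʳ (strip i′))
    (lex-< stripWidth hub<i′ (offset<stripWidth c))

  module Drawing where

    open Rational using (0ℚ; 1ℚ; _+_; _*_; _-_; _≤_; _<_)
    open Plane
    open +-*-Solver using (solve; _:+_; _:*_; _:-_; _:=_; con)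

    coord : ∀ {a} → Curve a → ℚ
    coord c = ⟦ param c ⟧

    W β : ℚ
    W = ⟦ stripWidth ⟧
    β = 0ℚ - (1ℚ + W * W)

    pos : Vertex → Pt
    pos v₀             = 0ℚ , β - 1ℚ
    pos (v₁ i)         = ⟦ strip i ⟧ , β
    pos (v₂ i j)       = parabola (coord (curve₂ i j))
    pos (v₃ i j l)     = parabola (coord (curve₃ i j l))
    pos (v₄ i j l m)   = parabola (coord (curve₄ i j l m))

    pos-curve : ∀ {a} (c : Curve a) → pos a ≡ parabola (coord c)
    pos-curve (curve₂ _ _)     = refl
    pos-curve (curve₃ _ _ _)   = refl
    pos-curve (curve₄ _ _ _ _) = refl

    β<0 : β < 0ℚ
    β<0 = 0<q-p⇒p<q (subst (0ℚ <_) (β-flip (W * W)) (ℚP.+-mono-<-≤ (⟦<⟧ (s≤s z≤n)) (square-nonNeg W)))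
      where β-flip : ∀ w → 1ℚ + w ≡ 0ℚ - (0ℚ - (1ℚ + w))
            β-flip = solve 1 (λ w → con 1ℚ :+ w := con 0ℚ :- (con 0ℚ :- (con 1ℚ :+ w))) refl

    β-1<β : β - 1ℚ < β
    β-1<β = 0<q-p⇒p<q (subst (0ℚ <_) (one β) (⟦<⟧ (s≤s z≤n)))
      where one : ∀ b → 1ℚ ≡ b - (b - 1ℚ)
            one = solve 1 (λ b → con 1ℚ := b :- (b :- con 1ℚ)) refl

    β<square : ∀ t → β < t * t
    β<square t = ℚP.<-≤-trans β<0 (square-nonNeg t)

    -- β = -(1 + W²) is chosen so that this holds whatever the offset e < W of c in its strip.
    hub-below-tangent : ∀ {a} (c : Curve a) →
                        β + coord c * coord c - (coord c + coord c) * ⟦ strip (hub-of c) ⟧ < 0ℚ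
    hub-below-tangent c = begin-strict
      β + coord c * coord c - (coord c + coord c) * s  ≡⟨ cong (λ t → β + t * t - (t + t) * s) coord≡s+e ⟩
      β + (s + e) * (s + e) - ((s + e) + (s + e)) * s  ≡⟨ regroup s e W ⟩
      0ℚ - gap                                         <⟨ 0<q-p⇒p<q (subst (0ℚ <_) (negate gap) gap>0) ⟩
      0ℚ                                               ∎
      where
      open ℚP.≤-Reasoning
      s e gap : ℚ
      s   = ⟦ strip (hub-of c) ⟧
      e   = ⟦ offset c ⟧
      gap = (W * W - e * e) + (1ℚ + s * s)
      coord≡s+e : coord c ≡ s + e
      coord≡s+e = trans (cong ⟦_⟧ (param≡strip+offset c)) (⟦+⟧ (strip (hub-of c)) (offset c))
      regroup : ∀ s e w → (0ℚ - (1ℚ + w * w)) + (s + e) * (s + e) - ((s + e) + (s + e)) * s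
                          ≡ 0ℚ - ((w * w - e * e) + (1ℚ + s * s))
      regroup = solve 3 (λ s e w → (con 0ℚ :- (con 1ℚ :+ w :* w)) :+ (s :+ e) :* (s :+ e) :- ((s :+ e) :+ (s :+ e)) :* s
                          := con 0ℚ :- ((w :* w :- e :* e) :+ (con 1ℚ :+ s :* s))) refl
      negate : ∀ q → q ≡ 0ℚ - (0ℚ - q)
      negate = solve 1 (λ q → q := con 0ℚ :- (con 0ℚ :- q)) refl
      e²<W² : e * e < W * W
      e²<W² = subst₂ _<_ (⟦*⟧ (offset c) (offset c)) (⟦*⟧ stripWidth stripWidth)
                         (⟦<⟧ (ℕP.*-mono-< (offset<stripWidth c) (offset<stripWidth c)))
      gap>0 : 0ℚ < gap
      gap>0 = ℚP.+-mono-<-≤ (0<q-p e²<W²) (ℚP.+-mono-≤ (ℚP.<⇒≤ (⟦<⟧ (s≤s z≤n))) (square-nonNeg s))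

    data Chord : Vertex → Vertex → Set where
      chord₂₃ : ∀ i j l   → Chord (v₂ i j) (v₃ i j l)
      chord₃₄ : ∀ i j l m → Chord (v₃ i j l) (v₄ i j l m)

    chord-start : ∀ {a b} → Chord a b → Curve a
    chord-start (chord₂₃ i j _)   = curve₂ i j
    chord-start (chord₃₄ i j l _) = curve₃ i j l

    chord-end : ∀ {a b} → Chord a b → Curve b
    chord-end (chord₂₃ i j l)   = curve₃ i j l
    chord-end (chord₃₄ i j l m) = curve₄ i j l m

    chord-increasing : ∀ {a b} (ch : Chord a b) → param (chord-start ch) ℕ.≤ param (chord-end ch)
    chord-increasing (chord₂₃ i j l)   = ℕP.+-monoʳ-≤ (block (curve₂ i j) ℕ.* cell) z≤n
    chord-increasing (chord₃₄ i j l m) =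
      ℕP.+-monoʳ-≤ (block (curve₃ i j l) ℕ.* cell) (ℕP.+-monoʳ-≤ (suc (toℕ l) ℕ.* radix) z≤n)

    on-chord : ∀ {a b p} (ch : Chord a b) → OnSeg p (pos a) (pos b) →
               OnSeg p (parabola (coord (chord-start ch))) (parabola (coord (chord-end ch)))
    on-chord (chord₂₃ _ _ _)   p∈ab = p∈ab
    on-chord (chord₃₄ _ _ _ _) p∈ab = p∈ab

    on-spoke : ∀ {b p} (c : Curve b) → OnSeg p (pos (v₁ (hub-of c))) (pos b) →
               OnSeg p (⟦ strip (hub-of c) ⟧ , β) (parabola (coord c))
    on-spoke {p = p} c = subst (OnSeg p (⟦ strip (hub-of c) ⟧ , β)) (pos-curve c)

    data Segment : Vertex → Vertex → Set where
      stem  : ∀ i → Segment v₀ (v₁ i)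
      spoke : ∀ {b} (c : Curve b) → Segment (v₁ (hub-of c)) b
      chord : ∀ {a b} → Chord a b → Segment a b

    Arc⇒Segment : ∀ {a b} → Arc a b → Segment a b
    Arc⇒Segment (arc₀₁ i)       = stem i
    Arc⇒Segment (arc₁₂ i j)     = spoke (curve₂ i j)
    Arc⇒Segment (arc₁₃ i j l)   = spoke (curve₃ i j l)
    Arc⇒Segment (arc₂₃ i j l)   = chord (chord₂₃ i j l)
    Arc⇒Segment (arc₃₄ i j l m) = chord (chord₃₄ i j l m)

    data Place : Vertex → Set where
      at-root  : Place v₀
      at-hub   : ∀ i → Place (v₁ i)
      on-curve : ∀ {a} → Curve a → Place a

    place : ∀ a → Place a
    place v₀             = at-root
    place (v₁ i)         = at-hub i
    place (v₂ i j)       = on-curve (curve₂ i j)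
    place (v₃ i j l)     = on-curve (curve₃ i j l)
    place (v₄ i j l m)   = on-curve (curve₄ i j l m)

    stem-low : ∀ {p i} → OnSeg p (pos v₀) (pos (v₁ i)) → Y p ≤ β
    stem-low {p} {i} p∈ = OnSeg⇒Y≤ {p} {pos v₀} {pos (v₁ i)} p∈ (ℚP.<⇒≤ β-1<β) ℚP.≤-refl

    spoke-high : ∀ {p b} (c : Curve b) → OnSeg p (pos (v₁ (hub-of c))) (pos b) → β ≤ Y p
    spoke-high {p} c p∈ = OnSeg⇒Y≥ {p} {⟦ strip (hub-of c) ⟧ , β} {parabola (coord c)} (on-spoke c p∈)
                                   ℚP.≤-refl (ℚP.<⇒≤ (β<square (coord c)))

    chord-high : ∀ {p a b} (ch : Chord a b) → OnSeg p (pos a) (pos b) → 0ℚ ≤ Y p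
    chord-high {p} ch p∈ = chord-nonNeg {p} (⟦≤⟧ (chord-increasing ch)) (on-chord ch p∈)

    curve-high : ∀ {a} (c : Curve a) → 0ℚ ≤ Y (pos a)
    curve-high c = subst (λ q → 0ℚ ≤ Y q) (sym (pos-curve c)) (square-nonNeg (coord c))

    coord-injective : ∀ {a b} (c : Curve a) (c′ : Curve b) → coord c ≡ coord c′ → a ≡ b
    coord-injective c c′ = param-injective c c′ ∘ ⟦⟧-injective

    avoids : ∀ {a b w} → Place w → Segment a b → w ≢ a → w ≢ b → ¬ OnSeg (pos w) (pos a) (pos b)
    avoids at-root (stem i) w≢a _ _ = w≢a refl
    avoids at-root (spoke c) _ _ w∈ = ℚP.<-irrefl refl (ℚP.<-≤-trans β-1<β (spoke-high c w∈))
    avoids at-root (chord ch) _ _ w∈ = ℚP.<-irrefl refl (ℚP.<-≤-trans (ℚP.<-trans β-1<β β<0) (chord-high ch w∈))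
    avoids (at-hub k) (stem i) _ k≢i w∈ =
      k≢i (cong v₁ (strip-injective (⟦⟧-injective
        (falling-OnSeg {pos (v₁ k)} {pos (v₁ i)} {pos v₀} (OnSeg-sym {pos (v₁ k)} {pos v₀} {pos (v₁ i)} w∈) β-1<β ℚP.≤-refl))))
    avoids (at-hub k) (spoke c) k≢hub _ w∈ with ℕP.<-cmp (toℕ k) (toℕ (hub-of c))
    ... | tri< k<hub _ _ = ℚP.<-irrefl refl (ℚP.<-≤-trans (⟦<⟧ (strip-< k<hub))
            (OnSeg⇒X≥ {pos (v₁ k)} {⟦ strip (hub-of c) ⟧ , β} {parabola (coord c)} (on-spoke c w∈)
                      ℚP.≤-refl (⟦≤⟧ (strip≤param c))))
    ... | tri≈ _ k≡hub _ = k≢hub (cong v₁ (FinP.toℕ-injective k≡hub))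
    ... | tri> _ _ hub<k = ℚP.<-irrefl refl
            (OnSeg⇒X< {pos (v₁ k)} {⟦ strip (hub-of c) ⟧ , β} {parabola (coord c)} (on-spoke c w∈)
                      (⟦<⟧ (strip-< hub<k)) (⟦<⟧ (param<strip c hub<k)))
    avoids (at-hub k) (chord ch) _ _ w∈ = ℚP.<-irrefl refl (ℚP.<-≤-trans β<0 (chord-high ch w∈))
    avoids {w = w} (on-curve c) (stem i) _ _ w∈ =
      ℚP.<-irrefl refl (ℚP.<-≤-trans β<0 (ℚP.≤-trans (curve-high c) (stem-low {pos w} {i} w∈)))
    avoids {b = b} (on-curve c) (spoke c′) _ w≢b w∈ =
      [ (λ same → w≢b (coord-injective c c′ (cong X same))) , (λ below → ℚP.<-irrefl refl below) ]′
        (below-tangent⇒under-parabola {parabola (coord c)} {⟦ strip (hub-of c′) ⟧} {β} {coord c′}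
           (hub-below-tangent c′) (on-spoke c′ (subst (λ q → OnSeg q (pos (v₁ (hub-of c′))) (pos b)) (pos-curve c) w∈)))
    avoids {a} {b} (on-curve c) (chord ch) w≢a w≢b w∈ =
      parabola-on-chord⇒endpoint {coord c} {coord (chord-start ch)} {coord (chord-end ch)} (⟦≤⟧ (chord-increasing ch))
        (on-chord ch (subst (λ q → OnSeg q (pos a) (pos b)) (pos-curve c) w∈))
        (w≢a ∘ coord-injective c (chord-start ch)) (w≢b ∘ coord-injective c (chord-end ch))

    stem-spoke-disjoint : ∀ {b} i (c : Curve b) → v₁ i ≢ v₁ (hub-of c) →
                          ¬ SegsMeet (pos v₀) (pos (v₁ i)) (pos (v₁ (hub-of c))) (pos b)
    stem-spoke-disjoint {b} i c i≢hub (p , p∈stem , p∈spoke) =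
      i≢hub (cong v₁ (strip-injective (⟦⟧-injective (trans (sym at-i) at-its-hub))))
      where
      at-i : X p ≡ ⟦ strip i ⟧
      at-i = falling-OnSeg {p} {pos (v₁ i)} {pos v₀} (OnSeg-sym {p} {pos v₀} {pos (v₁ i)} p∈stem)
                           β-1<β (spoke-high c p∈spoke)
      at-its-hub : X p ≡ ⟦ strip (hub-of c) ⟧
      at-its-hub = rising-OnSeg {p} {⟦ strip (hub-of c) ⟧ , β} {parabola (coord c)} (on-spoke c p∈spoke)
                            (β<square (coord c)) (stem-low {p} {i} p∈stem)

    stem-chord-disjoint : ∀ {a b} i (ch : Chord a b) → ¬ SegsMeet (pos v₀) (pos (v₁ i)) (pos a) (pos b)
    stem-chord-disjoint i ch (p , p∈stem , p∈chord) =
      ℚP.<-irrefl refl (ℚP.<-≤-trans β<0 (ℚP.≤-trans (chord-high ch p∈chord) (stem-low {p} {i} p∈stem)))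

    ordered-spokes-disjoint : ∀ {b b′} (c : Curve b) (c′ : Curve b′) → toℕ (hub-of c) ℕ.< toℕ (hub-of c′) →
                              ¬ SegsMeet (pos (v₁ (hub-of c))) (pos b) (pos (v₁ (hub-of c′))) (pos b′)
    ordered-spokes-disjoint c c′ hub<hub′ (p , p∈spoke , p∈spoke′) = ℚP.<-irrefl refl (ℚP.<-≤-trans left right)
      where
      left : X p < ⟦ strip (hub-of c′) ⟧
      left = OnSeg⇒X< {p} {⟦ strip (hub-of c) ⟧ , β} {parabola (coord c)} (on-spoke c p∈spoke)
                      (⟦<⟧ (strip-< hub<hub′)) (⟦<⟧ (param<strip c hub<hub′))
      right : ⟦ strip (hub-of c′) ⟧ ≤ X p
      right = OnSeg⇒X≥ {p} {⟦ strip (hub-of c′) ⟧ , β} {parabola (coord c′)} (on-spoke c′ p∈spoke′)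
                       ℚP.≤-refl (⟦≤⟧ (strip≤param c′))

    spokes-disjoint : ∀ {b b′} (c : Curve b) (c′ : Curve b′) → v₁ (hub-of c) ≢ v₁ (hub-of c′) →
                      ¬ SegsMeet (pos (v₁ (hub-of c))) (pos b) (pos (v₁ (hub-of c′))) (pos b′)
    spokes-disjoint c c′ hub≢hub′ (p , p∈spoke , p∈spoke′) with ℕP.<-cmp (toℕ (hub-of c)) (toℕ (hub-of c′))
    ... | tri< hub<hub′ _ _ = ordered-spokes-disjoint c c′ hub<hub′ (p , p∈spoke , p∈spoke′)
    ... | tri≈ _ hub≡hub′ _ = hub≢hub′ (cong v₁ (FinP.toℕ-injective hub≡hub′))
    ... | tri> _ _ hub′<hub = ordered-spokes-disjoint c′ c hub′<hub (p , p∈spoke′ , p∈spoke)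

    spoke-chord-disjoint : ∀ {a b d} (c : Curve d) (ch : Chord a b) → d ≢ a → d ≢ b →
                           ¬ SegsMeet (pos (v₁ (hub-of c))) (pos d) (pos a) (pos b)
    spoke-chord-disjoint c ch d≢a d≢b (p , p∈spoke , p∈chord)
      = [ (λ { refl → parabola-on-chord⇒endpoint {coord c} {coord (chord-start ch)} {coord (chord-end ch)}
                        (⟦≤⟧ (chord-increasing ch)) (on-chord ch p∈chord)
                        (d≢a ∘ coord-injective c (chord-start ch)) (d≢b ∘ coord-injective c (chord-end ch)) })
        , (λ below → ℚP.<-irrefl refl (ℚP.<-≤-trans below
             (chord-above {p} {coord (chord-start ch)} {coord (chord-end ch)} (⟦≤⟧ (chord-increasing ch)) (on-chord ch p∈chord))))
        ]′ (below-tangent⇒under-parabola {p} {⟦ strip (hub-of c) ⟧} {β} {coord c} (hub-below-tangent c) (on-spoke c p∈spoke))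

    data BlockOrder (i j i′ j′ : Fin K) : Set where
      lower  : toℕ (combine i j) ℕ.< toℕ (combine i′ j′) → BlockOrder i j i′ j′
      same   : i ≡ i′ → j ≡ j′ → BlockOrder i j i′ j′
      higher : toℕ (combine i′ j′) ℕ.< toℕ (combine i j) → BlockOrder i j i′ j′

    compare-blocks : ∀ i j i′ j′ → BlockOrder i j i′ j′
    compare-blocks i j i′ j′ with ℕP.<-cmp (toℕ (combine i j)) (toℕ (combine i′ j′))
    ... | tri< lt _ _ = lower lt
    ... | tri≈ _ eq _ = let i≡i′ , j≡j′ = FinP.combine-injective i j i′ j′ (FinP.toℕ-injective eq) in same i≡i′ j≡j′
    ... | tri> _ _ gt = higher gt

    chords-laminar : ∀ {a b c d} (ch : Chord a b) (ch′ : Chord c d) → a ≢ c → a ≢ d → b ≢ c → b ≢ d →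
                     Laminar (param (chord-start ch)) (param (chord-end ch)) (param (chord-start ch′)) (param (chord-end ch′))
    chords-laminar (chord₂₃ i j l) (chord₂₃ i′ j′ l′) a≢c _ _ _ with compare-blocks i j i′ j′
    ... | lower B<B′  = before (lex-< cell B<B′ (inner<cell (curve₃ i j l)))
    ... | higher B′<B = after (lex-< cell B′<B (inner<cell (curve₃ i′ j′ l′)))
    ... | same refl refl = ⊥-elim (a≢c refl)
    chords-laminar (chord₂₃ i j l) (chord₃₄ i′ j′ l′ m′) _ _ b≢c _ with compare-blocks i j i′ j′
    ... | lower B<B′  = before (lex-< cell B<B′ (inner<cell (curve₃ i j l)))
    ... | higher B′<B = after (lex-< cell B′<B (inner<cell (curve₄ i′ j′ l′ m′)))
    ... | same refl refl with ℕP.<-cmp (toℕ l) (toℕ l′)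
    ...   | tri< l<l′ _ _ = before (ℕP.+-monoʳ-< _ (lex-< radix (s≤s l<l′) (s≤s z≤n)))
    ...   | tri≈ _ l≡l′ _ = ⊥-elim (b≢c (cong (v₃ i j) (FinP.toℕ-injective l≡l′)))
    ...   | tri> _ _ l′<l = around (ℕP.+-monoʳ-< _ (s≤s z≤n))
                                   (ℕP.+-monoʳ-< _ (lex-< radix (s≤s l′<l) (s≤s (FinP.toℕ<n m′))))
    chords-laminar (chord₃₄ i j l m) (chord₂₃ i′ j′ l′) a≢c a≢d b≢c b≢d =
      Laminar-sym (chords-laminar (chord₂₃ i′ j′ l′) (chord₃₄ i j l m) (a≢c ∘ sym) (b≢c ∘ sym) (a≢d ∘ sym) (b≢d ∘ sym))
    chords-laminar (chord₃₄ i j l m) (chord₃₄ i′ j′ l′ m′) a≢c _ _ _ with compare-blocks i j i′ j′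
    ... | lower B<B′  = before (lex-< cell B<B′ (inner<cell (curve₄ i j l m)))
    ... | higher B′<B = after (lex-< cell B′<B (inner<cell (curve₄ i′ j′ l′ m′)))
    ... | same refl refl with ℕP.<-cmp (toℕ l) (toℕ l′)
    ...   | tri< l<l′ _ _ = before (ℕP.+-monoʳ-< _ (lex-< radix (s≤s l<l′) (s≤s (FinP.toℕ<n m))))
    ...   | tri≈ _ l≡l′ _ = ⊥-elim (a≢c (cong (v₃ i j) (FinP.toℕ-injective l≡l′)))
    ...   | tri> _ _ l′<l = after (ℕP.+-monoʳ-< _ (lex-< radix (s≤s l′<l) (s≤s (FinP.toℕ<n m′))))

    chords-disjoint : ∀ {a b c d} (ch : Chord a b) (ch′ : Chord c d) → a ≢ c → a ≢ d → b ≢ c → b ≢ d →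
                      ¬ SegsMeet (pos a) (pos b) (pos c) (pos d)
    chords-disjoint ch ch′ a≢c a≢d b≢c b≢d (p , p∈ch , p∈ch′) =
      laminar-chords-disjoint (chord-increasing ch) (chord-increasing ch′) (chords-laminar ch ch′ a≢c a≢d b≢c b≢d)
        (p , on-chord ch p∈ch , on-chord ch′ p∈ch′)

    segments-disjoint : ∀ {a b c d} → Segment a b → Segment c d → a ≢ c → a ≢ d → b ≢ c → b ≢ d →
                        ¬ SegsMeet (pos a) (pos b) (pos c) (pos d)
    segments-disjoint (stem _)   (stem _)    a≢c _   _   _   _ = a≢c refl
    segments-disjoint (stem i)   (spoke c)   _   _   b≢c _     = stem-spoke-disjoint i c b≢c
    segments-disjoint (stem i)   (chord ch)  _   _   _   _     = stem-chord-disjoint i ch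
    segments-disjoint (spoke c)  (stem i)    _   a≢d _   _   (p , p∈ab , p∈cd) =
      stem-spoke-disjoint i c (a≢d ∘ sym) (p , p∈cd , p∈ab)
    segments-disjoint (spoke c)  (spoke c′)  a≢c _   _   _     = spokes-disjoint c c′ a≢c
    segments-disjoint (spoke c)  (chord ch)  _   _   b≢c b≢d   = spoke-chord-disjoint c ch b≢c b≢d
    segments-disjoint (chord ch) (stem i)    _   _   _   _   (p , p∈ab , p∈cd) =
      stem-chord-disjoint i ch (p , p∈cd , p∈ab)
    segments-disjoint (chord ch) (spoke c)   _   a≢d _   b≢d (p , p∈ab , p∈cd) =
      spoke-chord-disjoint c ch (a≢d ∘ sym) (b≢d ∘ sym) (p , p∈cd , p∈ab)
    segments-disjoint (chord ch) (chord ch′) = chords-disjoint ch ch′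

    pos-injective : Injective _≡_ _≡_ pos
    pos-injective {a} {b} = apart (place a) (place b)
      where
      apart : ∀ {a b} → Place a → Place b → pos a ≡ pos b → a ≡ b
      apart at-root      at-root       _ = refl
      apart at-root      (at-hub _)    e = ⊥-elim (ℚP.<-irrefl (cong Y e) β-1<β)
      apart at-root      (on-curve c)  e = ⊥-elim (ℚP.<-irrefl (cong Y e) (ℚP.<-≤-trans (ℚP.<-trans β-1<β β<0) (curve-high c)))
      apart (at-hub _)   at-root       e = ⊥-elim (ℚP.<-irrefl (cong Y (sym e)) β-1<β)
      apart (at-hub _)   (at-hub _)    e = cong v₁ (strip-injective (⟦⟧-injective (cong X e)))
      apart (at-hub _)   (on-curve c)  e = ⊥-elim (ℚP.<-irrefl (cong Y e) (ℚP.<-≤-trans β<0 (curve-high c)))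
      apart (on-curve c) at-root       e = ⊥-elim (ℚP.<-irrefl (cong Y (sym e)) (ℚP.<-≤-trans (ℚP.<-trans β-1<β β<0) (curve-high c)))
      apart (on-curve c) (at-hub _)    e = ⊥-elim (ℚP.<-irrefl (cong Y (sym e)) (ℚP.<-≤-trans β<0 (curve-high c)))
      apart (on-curve c) (on-curve c′) e = coord-injective c c′ (cong X (trans (sym (pos-curve c)) (trans e (pos-curve c′))))

  open EnumeratedGraph enumeration adjacent adjacent-sym adjacent-irreflexive public

  graph-planar : Planar graph
  graph-planar = planar pos pos-injective avoids′ disjoint′
    where
    open Drawing
    open Plane using (OnSeg-sym; SegsMeet-swapˡ; SegsMeet-swapʳ)
    avoids′ : ∀ {a b w} → adjacent a b ≡ true → w ≢ a → w ≢ b → ¬ OnSeg (pos w) (pos a) (pos b)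
    avoids′ {a} {b} {w} ab w≢a w≢b with adjacent⇒Arc a b ab
    ... | inj₁ a→b = avoids (place w) (Arc⇒Segment a→b) w≢a w≢b
    ... | inj₂ b→a = avoids (place w) (Arc⇒Segment b→a) w≢b w≢a ∘ OnSeg-sym {pos w} {pos a} {pos b}
    disjoint′ : ∀ {a b c d} → adjacent a b ≡ true → adjacent c d ≡ true → a ≢ c → a ≢ d → b ≢ c → b ≢ d →
                ¬ SegsMeet (pos a) (pos b) (pos c) (pos d)
    disjoint′ {a} {b} {c} {d} ab cd a≢c a≢d b≢c b≢d with adjacent⇒Arc a b ab | adjacent⇒Arc c d cd
    ... | inj₁ a→b | inj₁ c→d = segments-disjoint (Arc⇒Segment a→b) (Arc⇒Segment c→d) a≢c a≢d b≢c b≢d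
    ... | inj₂ b→a | inj₁ c→d = segments-disjoint (Arc⇒Segment b→a) (Arc⇒Segment c→d) b≢c b≢d a≢c a≢d
                                  ∘ SegsMeet-swapˡ {pos a} {pos b} {pos c} {pos d}
    ... | inj₁ a→b | inj₂ d→c = segments-disjoint (Arc⇒Segment a→b) (Arc⇒Segment d→c) a≢d a≢c b≢d b≢c
                                  ∘ SegsMeet-swapʳ {pos a} {pos b} {pos c} {pos d}
    ... | inj₂ b→a | inj₂ d→c = segments-disjoint (Arc⇒Segment b→a) (Arc⇒Segment d→c) b≢d b≢c a≢d a≢c
                                  ∘ SegsMeet-swapʳ {pos b} {pos a} {pos c} {pos d} ∘ SegsMeet-swapˡ {pos a} {pos b} {pos c} {pos d}

-- Monochromatic spiders

Bool-split : ∀ b α → b ≡ α ⊎ b ≡ not α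
Bool-split false false = inj₁ refl
Bool-split false true  = inj₂ refl
Bool-split true  false = inj₂ refl
Bool-split true  true  = inj₁ refl

module MonochromaticSpider (N : ℕ) (colour : Host.Vertex (4 ℕ.* N) → Host.Vertex (4 ℕ.* N) → Bool) where

  open Host (4 ℕ.* N)

  K : ℕ
  K = 4 ℕ.* N

  Mono : Bool → Vertex → Vertex → Set
  Mono κ a b = Arc a b × colour a b ≡ κ

  MonoSpider : Set
  MonoSpider = ∃[ κ ] Spider (Mono κ) N

  Fan : Bool → Fin K → Set
  Fan κ i = AtLeast N (Mono κ (v₁ i))

  N+N≤1+2N : N ℕ.+ N ℕ.≤ suc (2 ℕ.* N)
  N+N≤1+2N = ℕP.m≤n⇒m≤1+n (ℕP.+-monoʳ-≤ N (ℕP.m≤m+n N 0))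

  N+N≤1+K : N ℕ.+ N ℕ.≤ suc K
  N+N≤1+K = ℕP.≤-trans N+N≤1+2N (s≤s (ℕP.*-monoˡ-≤ N {2} {4} (s≤s (s≤s z≤n))))

  colour-split : ∀ {M} a (nbr : Fin M → Vertex) α b c → b ℕ.+ c ℕ.≤ suc M →
                 AtLeast b (λ l → colour a (nbr l) ≡ α) ⊎ AtLeast c (λ l → colour a (nbr l) ≡ not α)
  colour-split {M} a nbr α = pigeonhole M (λ l → Bool-split (colour a (nbr l)) α)

  module Hub (i : Fin K) (α : Bool) where

    twig-split : ∀ j → AtLeast N (λ l → colour (v₂ i j) (v₃ i j l) ≡ not α)
                     ⊎ AtLeast (3 ℕ.* N) (λ l → colour (v₂ i j) (v₃ i j l) ≡ α)
    twig-split j =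
      pigeonhole K (λ l → Sum.swap (Bool-split (colour (v₂ i j) (v₃ i j l)) α)) N (3 ℕ.* N) (ℕP.n≤1+n _)

    leaf-split : ∀ j l → AtLeast N (λ m → colour (v₃ i j l) (v₄ i j l m) ≡ α)
                       ⊎ AtLeast N (λ m → colour (v₃ i j l) (v₄ i j l m) ≡ not α)
    leaf-split j l = colour-split (v₃ i j l) (v₄ i j l) α N N N+N≤1+K

    legs : ∀ {κ j l} → AtLeast N (λ m → colour (v₃ i j l) (v₄ i j l m) ≡ κ) → AtLeast N (Mono κ (v₃ i j l))
    legs = AtLeast-map _ v₄-injective (arc₃₄ i _ _ _ ,_)

    from-buds : ∀ j → AtLeast (3 ℕ.* N) (λ l → colour (v₂ i j) (v₃ i j l) ≡ α) → MonoSpider ⊎ Fan α i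
    from-buds j (pick ls ls-inj ls-α)
      with pigeonhole (3 ℕ.* N) (λ m → leaf-split j (ls m)) N (2 ℕ.* N) (ℕP.n≤1+n _)
    ... | inj₁ (pick ms ms-inj α-legs) =
      inj₁ (α , layered-spider proj₁ (v₂ i j)
                  (pick (λ r → v₃ i j (ls (ms r))) (ms-inj ∘ ls-inj ∘ v₃-injective)
                        (λ r → arc₂₃ i j _ , ls-α (ms r)))
                  (λ _ _ → refl) (legs ∘ α-legs))
    ... | inj₂ (pick ms ms-inj ᾱ-legs)
      with colour-split (v₁ i) (λ p → v₃ i j (ls (ms p))) α N N N+N≤1+2N
    ...   | inj₁ (pick ps ps-inj ps-α) =
      inj₂ (pick (λ r → v₃ i j (ls (ms (ps r)))) (ps-inj ∘ ms-inj ∘ ls-inj ∘ v₃-injective)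
                 (λ r → arc₁₃ i j _ , ps-α r))
    ...   | inj₂ (pick ps ps-inj ps-ᾱ) =
      inj₁ (not α , layered-spider proj₁ (v₁ i)
                      (pick (λ r → v₃ i j (ls (ms (ps r)))) (ps-inj ∘ ms-inj ∘ ls-inj ∘ v₃-injective)
                            (λ r → arc₁₃ i j _ , ps-ᾱ r))
                      (λ _ _ → refl) (legs ∘ ᾱ-legs ∘ ps))

    fan-or-spider : MonoSpider ⊎ Fan α i
    fan-or-spider with colour-split (v₁ i) (v₂ i) α N N N+N≤1+K
    ... | inj₁ (pick js js-inj js-α) =
      inj₂ (pick (v₂ i ∘ js) (js-inj ∘ v₂-injective) (λ r → arc₁₂ i _ , js-α r))
    ... | inj₂ (pick js js-inj js-ᾱ)
      with escape-or-all (λ r → Sum.swap (Sum.map₂ (js r ,_) (twig-split (js r))))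
    ...   | inj₁ (j , buds) = from-buds j buds
    ...   | inj₂ ᾱ-twigs =
      inj₁ (not α , layered-spider proj₁ (v₁ i)
                      (pick (v₂ i ∘ js) (js-inj ∘ v₂-injective) (λ r → arc₁₂ i _ , js-ᾱ r))
                      (λ _ _ → refl)
                      (λ r → AtLeast-map _ v₃-injective (arc₂₃ i _ _ ,_) (ᾱ-twigs r)))

  hub-fans-or-spider : ∀ i → MonoSpider ⊎ (Fan true i × Fan false i)
  hub-fans-or-spider i with Hub.fan-or-spider i true | Hub.fan-or-spider i false
  ... | inj₁ s | _      = inj₁ s
  ... | inj₂ _ | inj₁ s = inj₁ s
  ... | inj₂ t | inj₂ f = inj₂ (t , f)

  monochromatic-spider : MonoSpider
  monochromatic-spider with escape-or-all hub-fans-or-spider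
  ... | inj₁ s    = s
  ... | inj₂ fans with colour-split v₀ v₁ true N N N+N≤1+K
  ...   | inj₁ (pick is is-inj is-t) =
    true , layered-spider proj₁ v₀ (pick (v₁ ∘ is) (is-inj ∘ v₁-injective) (λ r → arc₀₁ _ , is-t r))
                  (λ _ _ → refl) (λ r → proj₁ (fans (is r)))
  ...   | inj₂ (pick is is-inj is-f) =
    false , layered-spider proj₁ v₀ (pick (v₁ ∘ is) (is-inj ∘ v₁-injective) (λ r → arc₀₁ _ , is-f r))
                   (λ _ _ → refl) (λ r → proj₂ (fans (is r)))

lemma4 : (T : Graph) → IsTree T → RadiusIs T 2 → PlanarUnavoidable T
lemma4 T (_ , _ , acyclic) ((c , near) , _) = graph , graph-planar , monochromatic-copy
  where
  open Host (4 ℕ.* n T)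
  open Inverse enumeration using (to)

  monochromatic-copy : (col : Colouring graph) → ∃[ κ ] MonoCopy T graph (proj₁ col) κ
  monochromatic-copy (col , col-sym) =
    κ , RadiusTwoTree.embed T acyclic c near {R = Good} Good-sym
          (Spider-map {S = Good} to to-injective Mono⇒Good spider)
    where
    open MonochromaticSpider (n T) (λ a b → col (to a) (to b))
    κ : Bool
    κ = proj₁ monochromatic-spider
    spider : Spider (Mono κ) (n T)
    spider = proj₂ monochromatic-spider
    Good : Fin (n graph) → Fin (n graph) → Set
    Good u v = Edge graph u v × col u v ≡ κ
    Good-sym : Symmetric Good
    Good-sym {u} {v} (uv , κ-uv) = Edge-sym graph {u} {v} uv , trans (col-sym v u) κ-uv
    Mono⇒Good : ∀ {a b} → Mono κ a b → Good (to a) (to b)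
    Mono⇒Good {a} {b} (a→b , κ-ab) = Edge-to {a} {b} (Arc⇒adjacent a→b) , κ-ab
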